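{- Let $p$ be a prime, $d\mid p-1$ with $1<d<p-1$. Suppose the pair $(A,B)$ of subsets of $\mathbb F_p$ is $d$-critical, with $|A|=\alpha$, $|B|=\beta$. For $b\in B$ let $\varepsilon(b)=1$ if $b\in B\cap(-A)$ and $\varepsilon(b)=0$ otherwise. Then there exists $C\in\mathbb F_p$ such that \[HP(x;A,d)=C\prod_{b\in B}(x-b)^{\alpha-\varepsilon(b)}.\]
   Context: $\mu_d$ is the set of $d$-th roots of unity in $\mathbb F_p$. A pair $(A,B)$ of subsets of $\mathbb F_p$ with $|A|,|B|>1$ is $d$-critical if $A+B\subseteq\mu_d\cup\{0\}$ and $|A||B|=d+|(-A)\cap B|$. For $A\subseteq\mathbb F_p$ with $|A|=\alpha>1$ and $\alpha+d-1<p$, the coefficients $c_a(A)\in\mathbb F_p$ ($a\in A$) are the unique elements with $\sum_{a\in A}c_a(A)a^m=0$ for $0\le m<\alpha-1$ and $\sum_{a\in A}c_a(A)a^{\alpha-1}=1$ (with $a^0=1$); equivalently $c_a(A)=\prod_{a'\in A\setminus\{a\}}(a-a')^{ -1}$. The Hanson–Petridis polynomial is $HP(x;A,d)=\sum_{a\in A}c_a(A)(x+a)^{d+\alpha-1}-1\in\mathbb F_p[x]$. -}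

module Defs where

open import Data.Nat as ℕ using (ℕ; zero; suc; NonZero; _∸_)
open import Data.Nat.DivMod using (_mod_)
open import Data.Fin as Fin using (Fin; toℕ)
open import Data.List using (List; []; _∷_; foldr; length; filter; upTo)
import Data.List.Membership.Propositional
import Data.Sum
open import Relation.Nullary using (Dec; yes; no; ¬_)
open import Relation.Binary.PropositionalEquality using (_≡_)

module Fp (p : ℕ) .{{_ : NonZero p}} where

  F : Set
  F = Fin p

  0F 1F : F
  0F = 0 mod p
  1F = 1 mod p

  -F_ : F → F
  -F x = (p ∸ toℕ x) mod p

  infixl 6 _+F_ _-F_
  infixl 7 _*F_
  _+F_ _*F_ _-F_ : F → F → F
  a +F b = (toℕ a ℕ.+ toℕ b) mod p
  a *F b = (toℕ a ℕ.* toℕ b) mod p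
  a -F b = a +F (-F b)

  _^F_ : F → ℕ → F
  a ^F zero = 1F
  a ^F suc n = a *F (a ^F n)

  -- multiplicative inverse (for a ≠ 0, p prime) via Fermat: a⁻¹ = a^(p-2)
  invF : F → F
  invF a = a ^F (p ∸ 2)

  sumF : List F → F
  sumF = foldr _+F_ 0F

  prodF : List F → F
  prodF = foldr _*F_ 1F

  _∈?_ : (x : F) (xs : List F) → Dec (Data.List.Membership.Propositional._∈_ x xs)
  _∈?_ = Data.List.Membership.DecPropositional._∈?_ Fin._≟_
    where open import Data.List.Membership.DecPropositional
          import Data.List.Membership.Propositional

  InMu : ℕ → F → Set
  InMu d x = x ^F d ≡ 1F

  negInter : List F → List F → List F
  negInter A B = filter (λ b → (-F b) ∈? A) B

  eps : List F → F → ℕ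
  eps A b with (-F b) ∈? A
  ... | yes _ = 1
  ... | no  _ = 0

  -- Polynomials over F_p as coefficient sequences (coefficient of x^k)
  Poly : Set
  Poly = ℕ → F

  const : F → Poly
  const c zero = c
  const c (suc _) = 0F

  X : Poly
  X zero = 0F
  X (suc zero) = 1F
  X (suc (suc _)) = 0F

  infixl 6 _+P_ _-P_
  infixl 7 _*P_
  _+P_ _-P_ : Poly → Poly → Poly
  (P +P Q) k = P k +F Q k
  (P -P Q) k = P k -F Q k

  _*P_ : Poly → Poly → Poly
  (P *P Q) k = sumF (Data.List.map (λ i → P i *F Q (k ∸ i)) (upTo (suc k)))
    where import Data.List

  scale : F → Poly → Poly
  scale c P k = c *F P k

  _^P_ : Poly → ℕ → Poly
  P ^P zero = const 1F
  P ^P suc n = P *P (P ^P n)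

  sumP : List Poly → Poly
  sumP = foldr _+P_ (const 0F)

  prodP : List Poly → Poly
  prodP = foldr _*P_ (const 1F)

  _≡P_ : Poly → Poly → Set
  P ≡P Q = ∀ k → P k ≡ Q k

  remove : F → List F → List F
  remove a [] = []
  remove a (x ∷ xs) with Fin._≟_ a x
  ... | yes _ = xs
  ... | no  _ = x ∷ remove a xs

  coef : List F → F → F
  coef A a = prodF (Data.List.map (λ a' → invF (a -F a')) (remove a A))
    where import Data.List

  HP : List F → ℕ → Poly
  HP A d = sumP (Data.List.map (λ a → scale (coef A a) ((X +P const a) ^P (d ℕ.+ length A ∸ 1))) A)
           -P const 1F
    where import Data.List

  -- d-critical pair (A, B); A, B are duplicate-free lists representing subsets of F_p
  record Critical (d : ℕ) (A B : List F) : Set where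
    field
      sizeA   : 1 ℕ.< length A
      sizeB   : 1 ℕ.< length B
      sumset  : ∀ {a b} → Data.List.Membership.Propositional._∈_ a A →
                Data.List.Membership.Propositional._∈_ b B →
                InMu d (a +F b) Data.Sum.⊎ (a +F b ≡ 0F)
      count   : length A ℕ.* length B ≡ d ℕ.+ length (negInter A B)

module Submission where

-- Write N = d + α - 1 and n = α - 1. Lagrange interpolation on the n + 1 points of A shows that
-- Σ_a c_a(A) (a + b)^k is 0 for k < n and 1 for k = n. In HP(x + b) = Σ_a c_a(A) (x + a + b)^N - 1 the
-- coefficient of x^j is binom(N, j) Σ_a c_a(A) (a + b)^(N - j) - [j = 0]; for j > d this vanishes, so
-- deg HP ≤ d, and for b ∈ B and j < α - ε(b) the sumset condition lets us replace (a + b)^(N - j) by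
-- (a + b)^(n - j), so it vanishes too: b is a root of HP of multiplicity at least α - ε(b). These
-- multiplicities add up to αβ - |(-A) ∩ B| = d, so the monic ∏_b (x - b)^(α - ε(b)) divides HP and has
-- degree at least deg HP, hence HP is a constant multiple of it.

open import Defs
open import Data.Nat using (ℕ; zero; suc; NonZero; >-nonZero; >-nonZero⁻¹; nonTrivial⇒n>1;
                            _+_; _*_; _∸_; _%_; _≤_; _<_; z≤n; s≤s; _!)
import Data.Nat.Properties as ℕₚ
open import Data.Nat.DivMod using (_mod_; m%n<n; m<n⇒m%n≡m; n%n≡0; %-distribˡ-+; %-distribˡ-*; m/n*n≡m)
open import Data.Nat.Divisibility using (_∣_; m∣m*n; ∣⇒≤; ∣1⇒≡1; m%n≡0⇒n∣m; n∣m⇒m%n≡0)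
open import Data.Nat.Primality using (Prime; euclidsLemma; prime⇒nonTrivial)
import Data.Nat.Combinatorics as Combinatorics
open import Data.Fin using (toℕ; _≟_)
open import Data.Fin.Properties using (toℕ-injective; toℕ<n; toℕ-fromℕ<)
open import Data.List using (List; []; _∷_; map; upTo; foldr; drop; length)
import Data.List.Properties as Listₚ
open import Data.List.Relation.Unary.All using (All; []; _∷_)
open import Data.List.Relation.Unary.All.Properties using (All¬⇒¬Any)
open import Data.List.Relation.Unary.Any using (here; there)
open import Data.List.Relation.Unary.AllPairs using (_∷_)
open import Data.List.Relation.Unary.Unique.Propositional using (Unique)
open import Data.List.Membership.Propositional using (_∈_)
open import Data.Product using (Σ; ∃; _×_; _,_; proj₁; proj₂)
open import Data.Sum using (_⊎_; inj₁; inj₂)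
open import Data.Empty using (⊥-elim)
open import Function using (_∘_; id)
open import Relation.Nullary using (¬_; yes; no)
open import Relation.Binary.PropositionalEquality
  using (_≡_; refl; sym; trans; cong; cong₂; subst; isEquivalence; module ≡-Reasoning)
import Relation.Binary.Reasoning.Setoid as SetoidReasoning
open import Algebra.Bundles using (CommutativeRing)
open import Algebra.Structures using (IsCommutativeRing)

module Residue (p : ℕ) .{{_ : NonZero p}} where
  open Fp p

  [_] : ℕ → F
  [ n ] = n mod p

  toℕ-[] : ∀ n → toℕ [ n ] ≡ n % p
  toℕ-[] n = toℕ-fromℕ< (m%n<n n p)

  [toℕ] : ∀ a → [ toℕ a ] ≡ a
  [toℕ] a = toℕ-injective (trans (toℕ-[] (toℕ a)) (m<n⇒m%n≡m (toℕ<n a)))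

  [+] : ∀ m n → [ m + n ] ≡ [ m ] +F [ n ]
  [+] m n = toℕ-injective (begin
    toℕ [ m + n ]                      ≡⟨ toℕ-[] _ ⟩
    (m + n) % p                        ≡⟨ %-distribˡ-+ m n p ⟩
    (m % p + n % p) % p                ≡⟨ cong₂ (λ u v → (u + v) % p) (toℕ-[] m) (toℕ-[] n) ⟨
    (toℕ [ m ] + toℕ [ n ]) % p        ≡⟨ toℕ-[] _ ⟨
    toℕ ([ m ] +F [ n ])               ∎)
    where open ≡-Reasoning

  [*] : ∀ m n → [ m * n ] ≡ [ m ] *F [ n ]
  [*] m n = toℕ-injective (begin
    toℕ [ m * n ]                      ≡⟨ toℕ-[] _ ⟩
    (m * n) % p                        ≡⟨ %-distribˡ-* m n p ⟩
    (m % p * (n % p)) % p              ≡⟨ cong₂ (λ u v → (u * v) % p) (toℕ-[] m) (toℕ-[] n) ⟨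
    (toℕ [ m ] * toℕ [ n ]) % p        ≡⟨ toℕ-[] _ ⟨
    toℕ ([ m ] *F [ n ])               ∎)
    where open ≡-Reasoning

  toℕ-0F : toℕ 0F ≡ 0
  toℕ-0F = trans (toℕ-[] 0) (m<n⇒m%n≡m (>-nonZero⁻¹ p))

  [p]≡0F : [ p ] ≡ 0F
  [p]≡0F = toℕ-injective (trans (toℕ-[] p) (trans (n%n≡0 p) (sym toℕ-0F)))

  -- Each law of F is the image of the corresponding law of ℕ under the surjection [_].
  +-assoc : ∀ a b c → (a +F b) +F c ≡ a +F (b +F c)
  +-assoc a b c = begin
    (a +F b) +F c                   ≡⟨ cong₂ (λ u v → (u +F v) +F c) ([toℕ] a) ([toℕ] b) ⟨
    ([ x ] +F [ y ]) +F c           ≡⟨ cong₂ _+F_ ([+] x y) ([toℕ] c) ⟨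
    [ x + y ] +F [ z ]              ≡⟨ [+] _ _ ⟨
    [ (x + y) + z ]                 ≡⟨ cong [_] (ℕₚ.+-assoc x y z) ⟩
    [ x + (y + z) ]                 ≡⟨ [+] _ _ ⟩
    [ x ] +F [ y + z ]              ≡⟨ cong₂ _+F_ ([toℕ] a) ([+] y z) ⟩
    a +F ([ y ] +F [ z ])           ≡⟨ cong₂ (λ u v → a +F (u +F v)) ([toℕ] b) ([toℕ] c) ⟩
    a +F (b +F c)                   ∎
    where open ≡-Reasoning
          x = toℕ a ; y = toℕ b ; z = toℕ c

  *-assoc : ∀ a b c → (a *F b) *F c ≡ a *F (b *F c)
  *-assoc a b c = begin
    (a *F b) *F c                   ≡⟨ cong₂ (λ u v → (u *F v) *F c) ([toℕ] a) ([toℕ] b) ⟨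
    ([ x ] *F [ y ]) *F c           ≡⟨ cong₂ _*F_ ([*] x y) ([toℕ] c) ⟨
    [ x * y ] *F [ z ]              ≡⟨ [*] _ _ ⟨
    [ (x * y) * z ]                 ≡⟨ cong [_] (ℕₚ.*-assoc x y z) ⟩
    [ x * (y * z) ]                 ≡⟨ [*] _ _ ⟩
    [ x ] *F [ y * z ]              ≡⟨ cong₂ _*F_ ([toℕ] a) ([*] y z) ⟩
    a *F ([ y ] *F [ z ])           ≡⟨ cong₂ (λ u v → a *F (u *F v)) ([toℕ] b) ([toℕ] c) ⟩
    a *F (b *F c)                   ∎
    where open ≡-Reasoning
          x = toℕ a ; y = toℕ b ; z = toℕ c

  +-comm : ∀ a b → a +F b ≡ b +F a
  +-comm a b = cong [_] (ℕₚ.+-comm (toℕ a) (toℕ b))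

  *-comm : ∀ a b → a *F b ≡ b *F a
  *-comm a b = cong [_] (ℕₚ.*-comm (toℕ a) (toℕ b))

  +-identityˡ : ∀ a → 0F +F a ≡ a
  +-identityˡ a = trans (cong (λ u → [ u + toℕ a ]) toℕ-0F) ([toℕ] a)

  *-identityˡ : ∀ a → 1F *F a ≡ a
  *-identityˡ a = begin
    1F *F a                ≡⟨ cong (1F *F_) ([toℕ] a) ⟨
    [ 1 ] *F [ toℕ a ]     ≡⟨ [*] 1 (toℕ a) ⟨
    [ 1 * toℕ a ]          ≡⟨ cong [_] (ℕₚ.*-identityˡ (toℕ a)) ⟩
    [ toℕ a ]              ≡⟨ [toℕ] a ⟩
    a                      ∎
    where open ≡-Reasoning

  *-distribʳ-+ : ∀ a b c → (b +F c) *F a ≡ (b *F a) +F (c *F a)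
  *-distribʳ-+ a b c = begin
    (b +F c) *F a                   ≡⟨ cong₂ (λ u v → (u +F v) *F a) ([toℕ] b) ([toℕ] c) ⟨
    ([ y ] +F [ z ]) *F a           ≡⟨ cong₂ _*F_ ([+] y z) ([toℕ] a) ⟨
    [ y + z ] *F [ x ]              ≡⟨ [*] _ _ ⟨
    [ (y + z) * x ]                 ≡⟨ cong [_] (ℕₚ.*-distribʳ-+ x y z) ⟩
    [ y * x + z * x ]               ≡⟨ [+] _ _ ⟩
    [ y * x ] +F [ z * x ]          ≡⟨ cong₂ _+F_ ([*] y x) ([*] z x) ⟩
    [ y ] *F [ x ] +F [ z ] *F [ x ] ≡⟨ cong₂ (λ u v → u *F v +F [ z ] *F v) ([toℕ] b) ([toℕ] a) ⟩
    b *F a +F [ z ] *F a            ≡⟨ cong (λ u → b *F a +F u *F a) ([toℕ] c) ⟩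
    b *F a +F c *F a                ∎
    where open ≡-Reasoning
          x = toℕ a ; y = toℕ b ; z = toℕ c

  -‿inverseˡ : ∀ a → (-F a) +F a ≡ 0F
  -‿inverseˡ a = begin
    (-F a) +F a             ≡⟨ cong ((-F a) +F_) ([toℕ] a) ⟨
    [ p ∸ x ] +F [ x ]      ≡⟨ [+] _ _ ⟨
    [ p ∸ x + x ]           ≡⟨ cong [_] (ℕₚ.m∸n+n≡m (ℕₚ.<⇒≤ (toℕ<n a))) ⟩
    [ p ]                   ≡⟨ [p]≡0F ⟩
    0F                      ∎
    where open ≡-Reasoning
          x = toℕ a

  isCommutativeRing : IsCommutativeRing _≡_ _+F_ _*F_ (λ u → -F u) 0F 1F
  isCommutativeRing = record
    { isRing = record
      { +-isAbelianGroup = record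
        { isGroup = record
          { isMonoid = record
            { isSemigroup = record
              { isMagma = record { isEquivalence = isEquivalence ; ∙-cong = cong₂ _+F_ }
              ; assoc = +-assoc }
            ; identity = +-identityˡ , λ a → trans (+-comm a 0F) (+-identityˡ a) }
          ; inverse = -‿inverseˡ , λ a → trans (+-comm a (-F a)) (-‿inverseˡ a)
          ; ⁻¹-cong = cong (λ u → -F u) }
        ; comm = +-comm }
      ; *-cong = cong₂ _*F_
      ; *-assoc = *-assoc
      ; *-identity = *-identityˡ , λ a → trans (*-comm a 1F) (*-identityˡ a)
      ; distrib = (λ a b c → trans (*-comm a (b +F c))
                               (trans (*-distribʳ-+ a b c) (cong₂ _+F_ (*-comm b a) (*-comm c a))))
                , *-distribʳ-+ }
    ; *-comm = *-comm }

  commutativeRing : CommutativeRing _ _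
  commutativeRing = record { isCommutativeRing = isCommutativeRing }

  open CommutativeRing commutativeRing public
    using (zeroˡ; zeroʳ; distribˡ; +-identityʳ; *-identityʳ; -‿inverseʳ)
  open import Algebra.Properties.Ring (CommutativeRing.ring commutativeRing) public
    using (-‿distribˡ-*; -‿distribʳ-*; -0#≈0#; -‿involutive; -‿+-comm; +-inverseˡ-unique; x∙y⁻¹≈ε⇒x≈y)
  open import Algebra.Properties.CommutativeSemigroup
    (CommutativeRing.+-commutativeSemigroup commutativeRing) public
    using () renaming (interchange to +-interchange; x∙yz≈y∙xz to +-swap)
  open import Algebra.Properties.CommutativeSemigroup
    (CommutativeRing.*-commutativeSemigroup commutativeRing) public
    using () renaming (x∙yz≈y∙xz to *-swap)

  ^F-+ : ∀ a m k → a ^F (m + k) ≡ a ^F m *F a ^F k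
  ^F-+ a zero    k = sym (*-identityˡ _)
  ^F-+ a (suc m) k = trans (cong (a *F_) (^F-+ a m k)) (sym (*-assoc a (a ^F m) (a ^F k)))

  sumF-cong : ∀ {I : Set} {f g : I → F} (is : List I) → (∀ i → f i ≡ g i) → sumF (map f is) ≡ sumF (map g is)
  sumF-cong is e = cong sumF (Listₚ.map-cong e is)

  sumF-zero : ∀ {I : Set} (f : I → F) is → (∀ i → f i ≡ 0F) → sumF (map f is) ≡ 0F
  sumF-zero f []       z = refl
  sumF-zero f (i ∷ is) z = trans (cong₂ _+F_ (z i) (sumF-zero f is z)) (+-identityˡ 0F)

  sumF-+ : ∀ {I : Set} (f g : I → F) is → sumF (map (λ i → f i +F g i) is) ≡ sumF (map f is) +F sumF (map g is)
  sumF-+ f g []       = sym (+-identityˡ 0F)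
  sumF-+ f g (i ∷ is) = trans (cong ((f i +F g i) +F_) (sumF-+ f g is)) (+-interchange (f i) (g i) _ _)

  sumF-*ˡ : ∀ {I : Set} c (f : I → F) is → sumF (map (λ i → c *F f i) is) ≡ c *F sumF (map f is)
  sumF-*ˡ c f []       = sym (zeroʳ c)
  sumF-*ˡ c f (i ∷ is) = trans (cong ((c *F f i) +F_) (sumF-*ˡ c f is)) (sym (distribˡ c (f i) _))

  sumF-cong-∈ : ∀ {f g : F → F} A → (∀ a → a ∈ A → f a ≡ g a) → sumF (map f A) ≡ sumF (map g A)
  sumF-cong-∈ []      e = refl
  sumF-cong-∈ (x ∷ A) e = cong₂ _+F_ (e x (here refl)) (sumF-cong-∈ A (λ a a∈A → e a (there a∈A)))

  sumF-single : ∀ (f : F → F) {a} A → Unique A → a ∈ A → (∀ c → c ∈ A → ¬ c ≡ a → f c ≡ 0F) → sumF (map f A) ≡ f a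
  sumF-single f (x ∷ A) (x∉A ∷ uA) (here refl) others =
    trans (cong (f x +F_) (rest A x∉A (λ c c∈A → others c (there c∈A)))) (+-identityʳ (f x))
    where
      rest : ∀ L → All (λ c → ¬ x ≡ c) L → (∀ c → c ∈ L → ¬ c ≡ x → f c ≡ 0F) → sumF (map f L) ≡ 0F
      rest []      _            _      = refl
      rest (y ∷ L) (x≢y ∷ x∉L) zeroes = trans (cong₂ _+F_ (zeroes y (here refl) (λ y≡x → x≢y (sym y≡x)))
                                                           (rest L x∉L (λ c c∈L → zeroes c (there c∈L))))
                                              (+-identityˡ 0F)
  sumF-single f (x ∷ A) (x∉A ∷ uA) (there a∈A) others =
    trans (cong₂ _+F_ (others x (here refl) x≢a) (sumF-single f A uA a∈A (λ c c∈A → others c (there c∈A))))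
          (+-identityˡ _)
    where
      x≢a : ¬ x ≡ _
      x≢a refl = All¬⇒¬Any x∉A a∈A

  prodF-zero : ∀ (h : F → F) {x} L → x ∈ L → h x ≡ 0F → prodF (map h L) ≡ 0F
  prodF-zero h (y ∷ L) (here refl) hx≡0 = trans (cong (_*F prodF (map h L)) hx≡0) (zeroˡ _)
  prodF-zero h (y ∷ L) (there x∈L) hx≡0 = trans (cong (h y *F_) (prodF-zero h L x∈L hx≡0)) (zeroʳ (h y))

-- Polynomials are coefficient lists, lowest degree first; `coeff` turns one into the coefficient sequence
-- `Poly` of Defs, and polynomials are compared through it, so trailing zeros do not matter.
module Polynomial (p : ℕ) .{{_ : NonZero p}} where
  open Fp p
  open Residue p
  open Combinatorics using (_C_; nCk+nC[k+1]≡[n+1]C[k+1]; k>n⇒nCk≡0)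

  Pol : Set
  Pol = List F

  coeff : Pol → Poly
  coeff []      k       = 0F
  coeff (a ∷ P) zero    = a
  coeff (a ∷ P) (suc k) = coeff P k

  infix 4 _≈_
  record _≈_ (P Q : Pol) : Set where
    constructor mk≈
    field coeff≡ : ∀ k → coeff P k ≡ coeff Q k
  open _≈_ public

  ≈-refl : ∀ {P} → P ≈ P
  ≈-refl = mk≈ λ _ → refl

  ≈-sym : ∀ {P Q} → P ≈ Q → Q ≈ P
  ≈-sym e = mk≈ λ k → sym (coeff≡ e k)

  ≈-trans : ∀ {P Q R} → P ≈ Q → Q ≈ R → P ≈ R
  ≈-trans e f = mk≈ λ k → trans (coeff≡ e k) (coeff≡ f k)

  ≈-reflexive : ∀ {P Q} → P ≡ Q → P ≈ Q
  ≈-reflexive refl = ≈-refl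

  ∷-cong : ∀ {a b P Q} → a ≡ b → P ≈ Q → (a ∷ P) ≈ (b ∷ Q)
  ∷-cong e f = mk≈ λ { zero → e ; (suc k) → coeff≡ f k }

  ∷-injectiveʳ : ∀ {a b P Q} → (a ∷ P) ≈ (b ∷ Q) → P ≈ Q
  ∷-injectiveʳ e = mk≈ λ k → coeff≡ e (suc k)

  ∷≈[] : ∀ {a P} → (a ∷ P) ≈ [] → P ≈ []
  ∷≈[] e = mk≈ λ k → coeff≡ e (suc k)

  ⟪_⟫ : F → Pol
  ⟪ c ⟫ = c ∷ []

  1ₚ : Pol
  1ₚ = ⟪ 1F ⟫

  ⟪0⟫≈[] : ⟪ 0F ⟫ ≈ []
  ⟪0⟫≈[] = mk≈ λ { zero → refl ; (suc k) → refl }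

  infixr 8 -ₚ_
  infixl 7 _•_ _⊗_
  infixl 6 _⊕_

  _⊕_ : Pol → Pol → Pol
  []      ⊕ Q       = Q
  (a ∷ P) ⊕ []      = a ∷ P
  (a ∷ P) ⊕ (b ∷ Q) = (a +F b) ∷ (P ⊕ Q)

  _•_ : F → Pol → Pol
  c • P = map (c *F_) P

  -ₚ_ : Pol → Pol
  -ₚ_ = map (λ a → -F a)

  _⊗_ : Pol → Pol → Pol
  []      ⊗ Q = []
  (a ∷ P) ⊗ Q = a • Q ⊕ (0F ∷ (P ⊗ Q))

  coeff-⊕ : ∀ P Q k → coeff (P ⊕ Q) k ≡ coeff P k +F coeff Q k
  coeff-⊕ []      Q       k       = sym (+-identityˡ (coeff Q k))
  coeff-⊕ (a ∷ P) []      k       = sym (+-identityʳ (coeff (a ∷ P) k))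
  coeff-⊕ (a ∷ P) (b ∷ Q) zero    = refl
  coeff-⊕ (a ∷ P) (b ∷ Q) (suc k) = coeff-⊕ P Q k

  coeff-• : ∀ c P k → coeff (c • P) k ≡ c *F coeff P k
  coeff-• c []      k       = sym (zeroʳ c)
  coeff-• c (a ∷ P) zero    = refl
  coeff-• c (a ∷ P) (suc k) = coeff-• c P k

  coeff--ₚ : ∀ P k → coeff (-ₚ P) k ≡ -F coeff P k
  coeff--ₚ []      k       = sym -0#≈0#
  coeff--ₚ (a ∷ P) zero    = refl
  coeff--ₚ (a ∷ P) (suc k) = coeff--ₚ P k

  sumF-upTo-suc : ∀ (f : ℕ → F) n → sumF (map f (upTo (suc n))) ≡ f 0 +F sumF (map (f ∘ suc) (upTo n))
  sumF-upTo-suc f n = cong (λ l → f 0 +F sumF l)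
    (trans (Listₚ.map-applyUpTo suc f n) (sym (Listₚ.map-applyUpTo id (f ∘ suc) n)))

  *P-cong : ∀ {f f′ g g′} → f ≡P f′ → g ≡P g′ → (f *P g) ≡P (f′ *P g′)
  *P-cong e e′ k = sumF-cong (upTo (suc k)) (λ i → cong₂ _*F_ (e i) (e′ (k ∸ i)))

  coeff-⊗ : ∀ P Q → coeff (P ⊗ Q) ≡P (coeff P *P coeff Q)
  coeff-⊗ []      Q k       = sym (sumF-zero _ (upTo (suc k)) (λ i → zeroˡ (coeff Q (k ∸ i))))
  coeff-⊗ (a ∷ P) Q zero    = trans (coeff-⊕ (a • Q) _ zero) (cong (_+F 0F) (coeff-• a Q zero))
  coeff-⊗ (a ∷ P) Q (suc k) = begin
    coeff (a • Q ⊕ (0F ∷ (P ⊗ Q))) (suc k)               ≡⟨ coeff-⊕ (a • Q) _ (suc k) ⟩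
    coeff (a • Q) (suc k) +F coeff (P ⊗ Q) k             ≡⟨ cong₂ _+F_ (coeff-• a Q (suc k)) (coeff-⊗ P Q k) ⟩
    a *F coeff Q (suc k) +F (coeff P *P coeff Q) k       ≡⟨ sumF-upTo-suc (λ i → coeff (a ∷ P) i *F coeff Q (suc k ∸ i)) (suc k) ⟨
    (coeff (a ∷ P) *P coeff Q) (suc k)                   ∎
    where open ≡-Reasoning

  ⊕-cong : ∀ {P P′ Q Q′} → P ≈ P′ → Q ≈ Q′ → P ⊕ Q ≈ P′ ⊕ Q′
  ⊕-cong {P} {P′} {Q} {Q′} e f = mk≈ λ k →
    trans (coeff-⊕ P Q k) (trans (cong₂ _+F_ (coeff≡ e k) (coeff≡ f k)) (sym (coeff-⊕ P′ Q′ k)))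

  •-cong : ∀ {c c′ P P′} → c ≡ c′ → P ≈ P′ → c • P ≈ c′ • P′
  •-cong {c} {c′} {P} {P′} e f = mk≈ λ k →
    trans (coeff-• c P k) (trans (cong₂ _*F_ e (coeff≡ f k)) (sym (coeff-• c′ P′ k)))

  -ₚ‿cong : ∀ {P P′} → P ≈ P′ → -ₚ P ≈ -ₚ P′
  -ₚ‿cong {P} {P′} e = mk≈ λ k →
    trans (coeff--ₚ P k) (trans (cong (λ u → -F u) (coeff≡ e k)) (sym (coeff--ₚ P′ k)))

  ⊗-cong : ∀ {P P′ Q Q′} → P ≈ P′ → Q ≈ Q′ → P ⊗ Q ≈ P′ ⊗ Q′
  ⊗-cong {P} {P′} {Q} {Q′} e f = mk≈ λ k →
    trans (coeff-⊗ P Q k) (trans (*P-cong (coeff≡ e) (coeff≡ f) k) (sym (coeff-⊗ P′ Q′ k)))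

  ⊕-comm : ∀ P Q → P ⊕ Q ≈ Q ⊕ P
  ⊕-comm P Q = mk≈ λ k →
    trans (coeff-⊕ P Q k) (trans (+-comm (coeff P k) (coeff Q k)) (sym (coeff-⊕ Q P k)))

  ⊕-assoc : ∀ P Q R → (P ⊕ Q) ⊕ R ≈ P ⊕ (Q ⊕ R)
  ⊕-assoc P Q R = mk≈ λ k → begin
    coeff ((P ⊕ Q) ⊕ R) k                  ≡⟨ coeff-⊕ (P ⊕ Q) R k ⟩
    coeff (P ⊕ Q) k +F coeff R k           ≡⟨ cong (_+F coeff R k) (coeff-⊕ P Q k) ⟩
    (coeff P k +F coeff Q k) +F coeff R k  ≡⟨ +-assoc (coeff P k) (coeff Q k) (coeff R k) ⟩
    coeff P k +F (coeff Q k +F coeff R k)  ≡⟨ cong (coeff P k +F_) (coeff-⊕ Q R k) ⟨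
    coeff P k +F coeff (Q ⊕ R) k           ≡⟨ coeff-⊕ P (Q ⊕ R) k ⟨
    coeff (P ⊕ (Q ⊕ R)) k                  ∎
    where open ≡-Reasoning

  ⊕-identityʳ : ∀ P → P ⊕ [] ≈ P
  ⊕-identityʳ P = mk≈ λ k → trans (coeff-⊕ P [] k) (+-identityʳ (coeff P k))

  ⊕-inverseʳ : ∀ P → P ⊕ -ₚ P ≈ []
  ⊕-inverseʳ P = mk≈ λ k →
    trans (coeff-⊕ P (-ₚ P) k) (trans (cong (coeff P k +F_) (coeff--ₚ P k)) (-‿inverseʳ (coeff P k)))

  •-⊗ : ∀ c P Q → c • P ⊗ Q ≈ c • (P ⊗ Q)
  •-⊗ c P Q = mk≈ λ k → begin
    coeff (c • P ⊗ Q) k                                            ≡⟨ coeff-⊗ (c • P) Q k ⟩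
    (coeff (c • P) *P coeff Q) k                                   ≡⟨ sumF-cong (upTo (suc k)) (λ i →
      trans (cong (_*F coeff Q (k ∸ i)) (coeff-• c P i)) (*-assoc c (coeff P i) (coeff Q (k ∸ i)))) ⟩
    sumF (map (λ i → c *F (coeff P i *F coeff Q (k ∸ i))) (upTo (suc k))) ≡⟨ sumF-*ˡ c _ (upTo (suc k)) ⟩
    c *F (coeff P *P coeff Q) k                                    ≡⟨ cong (c *F_) (coeff-⊗ P Q k) ⟨
    c *F coeff (P ⊗ Q) k                                           ≡⟨ coeff-• c (P ⊗ Q) k ⟨
    coeff (c • (P ⊗ Q)) k                                          ∎
    where open ≡-Reasoning

  ⊗-distribʳ : ∀ Q P P′ → (P ⊕ P′) ⊗ Q ≈ P ⊗ Q ⊕ P′ ⊗ Q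
  ⊗-distribʳ Q P P′ = mk≈ λ k → begin
    coeff ((P ⊕ P′) ⊗ Q) k                                         ≡⟨ coeff-⊗ (P ⊕ P′) Q k ⟩
    (coeff (P ⊕ P′) *P coeff Q) k                                  ≡⟨ sumF-cong (upTo (suc k)) (λ i →
      trans (cong (_*F coeff Q (k ∸ i)) (coeff-⊕ P P′ i)) (*-distribʳ-+ (coeff Q (k ∸ i)) (coeff P i) (coeff P′ i))) ⟩
    sumF (map (λ i → coeff P i *F coeff Q (k ∸ i) +F coeff P′ i *F coeff Q (k ∸ i)) (upTo (suc k)))
                                                                   ≡⟨ sumF-+ _ _ (upTo (suc k)) ⟩
    (coeff P *P coeff Q) k +F (coeff P′ *P coeff Q) k              ≡⟨ cong₂ _+F_ (coeff-⊗ P Q k) (coeff-⊗ P′ Q k) ⟨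
    coeff (P ⊗ Q) k +F coeff (P′ ⊗ Q) k                            ≡⟨ coeff-⊕ (P ⊗ Q) _ k ⟨
    coeff (P ⊗ Q ⊕ P′ ⊗ Q) k                                       ∎
    where open ≡-Reasoning

  ⊗-zeroʳ : ∀ P → P ⊗ [] ≈ []
  ⊗-zeroʳ P = mk≈ λ k → trans (coeff-⊗ P [] k) (sumF-zero _ (upTo (suc k)) (λ i → zeroʳ (coeff P i)))

  0•P≈[] : ∀ P → 0F • P ≈ []
  0•P≈[] P = mk≈ λ k → trans (coeff-• 0F P k) (zeroˡ (coeff P k))

  1•P≈P : ∀ P → 1F • P ≈ P
  1•P≈P P = mk≈ λ k → trans (coeff-• 1F P k) (*-identityˡ (coeff P k))

  0∷-⊗ : ∀ P Q → (0F ∷ P) ⊗ Q ≈ 0F ∷ (P ⊗ Q)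
  0∷-⊗ P Q = ⊕-cong (0•P≈[] Q) ≈-refl

  ⊕-swap : ∀ P Q R → P ⊕ (Q ⊕ R) ≈ Q ⊕ (P ⊕ R)
  ⊕-swap P Q R = ≈-trans (≈-sym (⊕-assoc P Q R)) (≈-trans (⊕-cong (⊕-comm P Q) ≈-refl) (⊕-assoc Q P R))

  ⊗-∷ʳ : ∀ P b Q → P ⊗ (b ∷ Q) ≈ b • P ⊕ (0F ∷ (P ⊗ Q))
  ⊗-∷ʳ []      b Q = mk≈ λ { zero → refl ; (suc k) → refl }
  ⊗-∷ʳ (a ∷ P) b Q = ∷-cong (cong (_+F 0F) (*-comm a b))
    (≈-trans (⊕-cong ≈-refl (⊗-∷ʳ P b Q)) (⊕-swap (a • Q) (b • P) (0F ∷ (P ⊗ Q))))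

  ⊗-comm : ∀ P Q → P ⊗ Q ≈ Q ⊗ P
  ⊗-comm []      Q = ≈-sym (⊗-zeroʳ Q)
  ⊗-comm (a ∷ P) Q = ≈-trans (⊕-cong ≈-refl (∷-cong refl (⊗-comm P Q))) (≈-sym (⊗-∷ʳ Q a P))

  ⊗-assoc : ∀ P Q R → (P ⊗ Q) ⊗ R ≈ P ⊗ (Q ⊗ R)
  ⊗-assoc []      Q R = ≈-refl
  ⊗-assoc (a ∷ P) Q R = ≈-trans (⊗-distribʳ R (a • Q) (0F ∷ (P ⊗ Q)))
    (⊕-cong (•-⊗ a Q R) (≈-trans (0∷-⊗ (P ⊗ Q) R) (∷-cong refl (⊗-assoc P Q R))))

  ⊗-identityˡ : ∀ P → 1ₚ ⊗ P ≈ P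
  ⊗-identityˡ P = ≈-trans (⊕-cong (1•P≈P P) (mk≈ λ { zero → refl ; (suc k) → refl })) (⊕-identityʳ P)

  ⊗-distribˡ : ∀ P Q Q′ → P ⊗ (Q ⊕ Q′) ≈ P ⊗ Q ⊕ P ⊗ Q′
  ⊗-distribˡ P Q Q′ =
    ≈-trans (⊗-comm P (Q ⊕ Q′)) (≈-trans (⊗-distribʳ P Q Q′) (⊕-cong (⊗-comm Q P) (⊗-comm Q′ P)))

  isCommutativeRingₚ : IsCommutativeRing _≈_ _⊕_ _⊗_ -ₚ_ [] 1ₚ
  isCommutativeRingₚ = record
    { isRing = record
      { +-isAbelianGroup = record
        { isGroup = record
          { isMonoid = record
            { isSemigroup = record
              { isMagma = record
                { isEquivalence = record { refl = ≈-refl ; sym = ≈-sym ; trans = ≈-trans }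
                ; ∙-cong = ⊕-cong }
              ; assoc = ⊕-assoc }
            ; identity = (λ P → ≈-refl) , ⊕-identityʳ }
          ; inverse = (λ P → ≈-trans (⊕-comm (-ₚ P) P) (⊕-inverseʳ P)) , ⊕-inverseʳ
          ; ⁻¹-cong = -ₚ‿cong }
        ; comm = ⊕-comm }
      ; *-cong = ⊗-cong
      ; *-assoc = ⊗-assoc
      ; *-identity = ⊗-identityˡ , (λ P → ≈-trans (⊗-comm P 1ₚ) (⊗-identityˡ P))
      ; distrib = ⊗-distribˡ , ⊗-distribʳ }
    ; *-comm = ⊗-comm }

  commutativeRingₚ : CommutativeRing _ _
  commutativeRingₚ = record { isCommutativeRing = isCommutativeRingₚ }

  module ≈-Reasoning = SetoidReasoning (CommutativeRing.setoid commutativeRingₚ)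
  open CommutativeRing commutativeRingₚ public using () renaming (*-identityʳ to ⊗-identityʳ)
  open import Algebra.Properties.CommutativeSemigroup
    (CommutativeRing.+-commutativeSemigroup commutativeRingₚ) public
    using () renaming (interchange to ⊕-interchange)
  open import Algebra.Properties.CommutativeSemigroup
    (CommutativeRing.*-commutativeSemigroup commutativeRingₚ) public
    using () renaming (x∙yz≈y∙xz to ⊗-swap)

  infixr 8 _^_
  _^_ : Pol → ℕ → Pol
  P ^ zero  = 1ₚ
  P ^ suc n = P ⊗ P ^ n

  ^-cong : ∀ {P Q} n → P ≈ Q → P ^ n ≈ Q ^ n
  ^-cong zero    e = ≈-refl
  ^-cong (suc n) e = ⊗-cong e (^-cong n e)

  sumₚ : List Pol → Pol
  sumₚ = foldr _⊕_ []

  coeff-sumₚ : ∀ {I : Set} (f : I → Pol) is k → coeff (sumₚ (map f is)) k ≡ sumF (map (λ i → coeff (f i) k) is)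
  coeff-sumₚ f []       k = refl
  coeff-sumₚ f (i ∷ is) k = trans (coeff-⊕ (f i) _ k) (cong (coeff (f i) k +F_) (coeff-sumₚ f is k))

  sumₚ-cong : ∀ {I : Set} {f g : I → Pol} (is : List I) → (∀ i → f i ≈ g i) → sumₚ (map f is) ≈ sumₚ (map g is)
  sumₚ-cong []       e = ≈-refl
  sumₚ-cong (i ∷ is) e = ⊕-cong (e i) (sumₚ-cong is e)

  •≈⟪⟫⊗ : ∀ c P → c • P ≈ ⟪ c ⟫ ⊗ P
  •≈⟪⟫⊗ c P = ≈-sym (≈-trans (⊕-cong ≈-refl ⟪0⟫≈[]) (⊕-identityʳ (c • P)))

  𝕏 : Pol
  𝕏 = 0F ∷ 1F ∷ []

  infix 10 𝕏+_
  𝕏+_ : F → Pol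
  𝕏+ c = 𝕏 ⊕ ⟪ c ⟫

  eval : Pol → F → F
  eval []      x = 0F
  eval (a ∷ P) x = a +F x *F eval P x

  eval-[] : ∀ {P} x → P ≈ [] → eval P x ≡ 0F
  eval-[] {[]}    x e = refl
  eval-[] {a ∷ P} x e = trans (cong₂ (λ u v → u +F x *F v) (coeff≡ e 0) (eval-[] x (∷≈[] e)))
    (trans (cong (0F +F_) (zeroʳ x)) (+-identityˡ 0F))

  eval-cong : ∀ {P Q} x → P ≈ Q → eval P x ≡ eval Q x
  eval-cong {[]}    {Q}     x e = sym (eval-[] x (≈-sym e))
  eval-cong {a ∷ P} {[]}    x e = eval-[] x e
  eval-cong {a ∷ P} {b ∷ Q} x e = cong₂ (λ u v → u +F x *F v) (coeff≡ e 0) (eval-cong x (∷-injectiveʳ e))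

  eval-⊕ : ∀ P Q x → eval (P ⊕ Q) x ≡ eval P x +F eval Q x
  eval-⊕ []      Q       x = sym (+-identityˡ (eval Q x))
  eval-⊕ (a ∷ P) []      x = sym (+-identityʳ (eval (a ∷ P) x))
  eval-⊕ (a ∷ P) (b ∷ Q) x = trans (cong (λ u → (a +F b) +F x *F u) (eval-⊕ P Q x))
    (trans (cong ((a +F b) +F_) (distribˡ x (eval P x) (eval Q x))) (+-interchange a b _ _))

  eval-• : ∀ c P x → eval (c • P) x ≡ c *F eval P x
  eval-• c []      x = sym (zeroʳ c)
  eval-• c (a ∷ P) x = trans (cong (λ u → c *F a +F x *F u) (eval-• c P x))
    (trans (cong (c *F a +F_) (*-swap x c (eval P x))) (sym (distribˡ c a (x *F eval P x))))

  eval--ₚ : ∀ P x → eval (-ₚ P) x ≡ -F eval P x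
  eval--ₚ []      x = sym -0#≈0#
  eval--ₚ (a ∷ P) x = trans (cong (λ u → (-F a) +F x *F u) (eval--ₚ P x))
    (trans (cong ((-F a) +F_) (sym (-‿distribʳ-* x (eval P x)))) (-‿+-comm a (x *F eval P x)))

  eval-⊗ : ∀ P Q x → eval (P ⊗ Q) x ≡ eval P x *F eval Q x
  eval-⊗ []      Q x = sym (zeroˡ (eval Q x))
  eval-⊗ (a ∷ P) Q x = begin
    eval (a • Q ⊕ (0F ∷ P ⊗ Q)) x                  ≡⟨ eval-⊕ (a • Q) (0F ∷ P ⊗ Q) x ⟩
    eval (a • Q) x +F (0F +F x *F eval (P ⊗ Q) x)  ≡⟨ cong₂ _+F_ (eval-• a Q x) (+-identityˡ _) ⟩
    a *F eval Q x +F x *F eval (P ⊗ Q) x           ≡⟨ cong (λ u → a *F eval Q x +F x *F u) (eval-⊗ P Q x) ⟩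
    a *F eval Q x +F x *F (eval P x *F eval Q x)   ≡⟨ cong (a *F eval Q x +F_) (*-assoc x (eval P x) (eval Q x)) ⟨
    a *F eval Q x +F (x *F eval P x) *F eval Q x   ≡⟨ *-distribʳ-+ (eval Q x) a (x *F eval P x) ⟨
    (a +F x *F eval P x) *F eval Q x               ∎
    where open ≡-Reasoning

  eval-⟪⟫ : ∀ c x → eval ⟪ c ⟫ x ≡ c
  eval-⟪⟫ c x = trans (cong (c +F_) (zeroʳ x)) (+-identityʳ c)

  eval-^ : ∀ P n x → eval (P ^ n) x ≡ eval P x ^F n
  eval-^ P zero    x = eval-⟪⟫ 1F x
  eval-^ P (suc n) x = trans (eval-⊗ P (P ^ n) x) (cong (eval P x *F_) (eval-^ P n x))

  eval-sumₚ : ∀ {I : Set} (f : I → Pol) is x → eval (sumₚ (map f is)) x ≡ sumF (map (λ i → eval (f i) x) is)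
  eval-sumₚ f []       x = refl
  eval-sumₚ f (i ∷ is) x = trans (eval-⊕ (f i) _ x) (cong (eval (f i) x +F_) (eval-sumₚ f is x))

  eval-𝕏+ : ∀ c x → eval (𝕏+ c) x ≡ x +F c
  eval-𝕏+ c x = trans (eval-⊕ 𝕏 ⟪ c ⟫ x)
    (cong₂ _+F_ (trans (+-identityˡ _) (trans (cong (x *F_) (eval-⟪⟫ 1F x)) (*-identityʳ x))) (eval-⟪⟫ c x))

  infix 10 𝕏-_
  𝕏-_ : F → Pol
  𝕏- b = (-F b) ∷ 1F ∷ []

  eval-𝕏- : ∀ b x → eval (𝕏- b) x ≡ x -F b
  eval-𝕏- b x = trans (cong (λ u → (-F b) +F x *F u) (eval-⟪⟫ 1F x))
    (trans (cong ((-F b) +F_) (*-identityʳ x)) (+-comm (-F b) x))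

  𝕏-⊗ : ∀ b R → 𝕏- b ⊗ R ≈ (-F b) • R ⊕ (0F ∷ R)
  𝕏-⊗ b R = ⊕-cong (≈-refl {(-F b) • R}) (∷-cong refl (⊗-identityˡ R))

  coeff-𝕏-⊗-zero : ∀ b R → coeff (𝕏- b ⊗ R) 0 ≡ (-F b) *F coeff R 0
  coeff-𝕏-⊗-zero b R = trans (coeff≡ (𝕏-⊗ b R) 0)
    (trans (coeff-⊕ ((-F b) • R) (0F ∷ R) 0) (trans (+-identityʳ _) (coeff-• (-F b) R 0)))

  coeff-𝕏-⊗-suc : ∀ b R k → coeff (𝕏- b ⊗ R) (suc k) ≡ (-F b) *F coeff R (suc k) +F coeff R k
  coeff-𝕏-⊗-suc b R k = trans (coeff≡ (𝕏-⊗ b R) (suc k))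
    (trans (coeff-⊕ ((-F b) • R) (0F ∷ R) (suc k)) (cong (_+F coeff R k) (coeff-• (-F b) R (suc k))))

  rootProduct : (F → ℕ) → List F → Pol
  rootProduct m []      = 1ₚ
  rootProduct m (b ∷ B) = 𝕏- b ^ m b ⊗ rootProduct m B

  rootCount : (F → ℕ) → List F → ℕ
  rootCount m []      = 0
  rootCount m (b ∷ B) = m b + rootCount m B

  infixl 9 _∘ₚ_
  _∘ₚ_ : Pol → Pol → Pol
  []      ∘ₚ Y = []
  (a ∷ P) ∘ₚ Y = ⟪ a ⟫ ⊕ Y ⊗ P ∘ₚ Y

  ∘ₚ-⊕ : ∀ P Q Y → (P ⊕ Q) ∘ₚ Y ≈ P ∘ₚ Y ⊕ Q ∘ₚ Y
  ∘ₚ-⊕ []      Q       Y = ≈-refl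
  ∘ₚ-⊕ (a ∷ P) []      Y = ≈-sym (⊕-identityʳ _)
  ∘ₚ-⊕ (a ∷ P) (b ∷ Q) Y = begin
    ⟪ a +F b ⟫ ⊕ Y ⊗ (P ⊕ Q) ∘ₚ Y             ≈⟨ ⊕-cong (≈-refl {⟪ a +F b ⟫}) (⊗-cong (≈-refl {Y}) (∘ₚ-⊕ P Q Y)) ⟩
    ⟪ a +F b ⟫ ⊕ Y ⊗ (P ∘ₚ Y ⊕ Q ∘ₚ Y)        ≈⟨ ⊕-cong (≈-refl {⟪ a +F b ⟫}) (⊗-distribˡ Y (P ∘ₚ Y) (Q ∘ₚ Y)) ⟩
    (⟪ a ⟫ ⊕ ⟪ b ⟫) ⊕ (Y ⊗ P ∘ₚ Y ⊕ Y ⊗ Q ∘ₚ Y) ≈⟨ ⊕-interchange ⟪ a ⟫ ⟪ b ⟫ (Y ⊗ P ∘ₚ Y) (Y ⊗ Q ∘ₚ Y) ⟩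
    (a ∷ P) ∘ₚ Y ⊕ (b ∷ Q) ∘ₚ Y                 ∎
    where open ≈-Reasoning

  ∘ₚ-⟪⟫ : ∀ c Y → ⟪ c ⟫ ∘ₚ Y ≈ ⟪ c ⟫
  ∘ₚ-⟪⟫ c Y = ≈-trans (⊕-cong (≈-refl {⟪ c ⟫}) (⊗-zeroʳ Y)) (⊕-identityʳ ⟪ c ⟫)

  ∘ₚ-0∷ : ∀ P Y → (0F ∷ P) ∘ₚ Y ≈ Y ⊗ P ∘ₚ Y
  ∘ₚ-0∷ P Y = ⊕-cong ⟪0⟫≈[] (≈-refl {Y ⊗ P ∘ₚ Y})

  ∘ₚ-• : ∀ c P Y → (c • P) ∘ₚ Y ≈ ⟪ c ⟫ ⊗ P ∘ₚ Y
  ∘ₚ-• c []      Y = ≈-sym (⊗-zeroʳ ⟪ c ⟫)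
  ∘ₚ-• c (a ∷ P) Y = begin
    ⟪ c *F a ⟫ ⊕ Y ⊗ (c • P) ∘ₚ Y          ≈⟨ ⊕-cong (•≈⟪⟫⊗ c ⟪ a ⟫) (⊗-cong (≈-refl {Y}) (∘ₚ-• c P Y)) ⟩
    ⟪ c ⟫ ⊗ ⟪ a ⟫ ⊕ Y ⊗ (⟪ c ⟫ ⊗ P ∘ₚ Y)    ≈⟨ ⊕-cong (≈-refl {⟪ c ⟫ ⊗ ⟪ a ⟫}) (⊗-swap Y ⟪ c ⟫ (P ∘ₚ Y)) ⟩
    ⟪ c ⟫ ⊗ ⟪ a ⟫ ⊕ ⟪ c ⟫ ⊗ (Y ⊗ P ∘ₚ Y)    ≈⟨ ⊗-distribˡ ⟪ c ⟫ ⟪ a ⟫ (Y ⊗ P ∘ₚ Y) ⟨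
    ⟪ c ⟫ ⊗ (a ∷ P) ∘ₚ Y                    ∎
    where open ≈-Reasoning

  ∘ₚ-⊗ : ∀ P Q Y → (P ⊗ Q) ∘ₚ Y ≈ P ∘ₚ Y ⊗ Q ∘ₚ Y
  ∘ₚ-⊗ []      Q Y = ≈-refl
  ∘ₚ-⊗ (a ∷ P) Q Y = begin
    (a • Q ⊕ (0F ∷ P ⊗ Q)) ∘ₚ Y              ≈⟨ ∘ₚ-⊕ (a • Q) (0F ∷ P ⊗ Q) Y ⟩
    (a • Q) ∘ₚ Y ⊕ (0F ∷ P ⊗ Q) ∘ₚ Y         ≈⟨ ⊕-cong (∘ₚ-• a Q Y) (∘ₚ-0∷ (P ⊗ Q) Y) ⟩
    ⟪ a ⟫ ⊗ Q ∘ₚ Y ⊕ Y ⊗ (P ⊗ Q) ∘ₚ Y        ≈⟨ ⊕-cong (≈-refl {⟪ a ⟫ ⊗ Q ∘ₚ Y}) (⊗-cong (≈-refl {Y}) (∘ₚ-⊗ P Q Y)) ⟩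
    ⟪ a ⟫ ⊗ Q ∘ₚ Y ⊕ Y ⊗ (P ∘ₚ Y ⊗ Q ∘ₚ Y)   ≈⟨ ⊕-cong (≈-refl {⟪ a ⟫ ⊗ Q ∘ₚ Y}) (⊗-assoc Y (P ∘ₚ Y) (Q ∘ₚ Y)) ⟨
    ⟪ a ⟫ ⊗ Q ∘ₚ Y ⊕ (Y ⊗ P ∘ₚ Y) ⊗ Q ∘ₚ Y   ≈⟨ ⊗-distribʳ (Q ∘ₚ Y) ⟪ a ⟫ (Y ⊗ P ∘ₚ Y) ⟨
    (a ∷ P) ∘ₚ Y ⊗ Q ∘ₚ Y                    ∎
    where open ≈-Reasoning

  ∘ₚ-^ : ∀ P n Y → (P ^ n) ∘ₚ Y ≈ (P ∘ₚ Y) ^ n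
  ∘ₚ-^ P zero    Y = ∘ₚ-⟪⟫ 1F Y
  ∘ₚ-^ P (suc n) Y = ≈-trans (∘ₚ-⊗ P (P ^ n) Y) (⊗-cong (≈-refl {P ∘ₚ Y}) (∘ₚ-^ P n Y))

  ∘ₚ-𝕏+ : ∀ c Y → (𝕏+ c) ∘ₚ Y ≈ Y ⊕ ⟪ c ⟫
  ∘ₚ-𝕏+ c Y = ≈-trans (∘ₚ-⊕ 𝕏 ⟪ c ⟫ Y) (⊕-cong 𝕏∘Y (∘ₚ-⟪⟫ c Y))
    where
      𝕏∘Y : 𝕏 ∘ₚ Y ≈ Y
      𝕏∘Y = ≈-trans (∘ₚ-0∷ 1ₚ Y) (≈-trans (⊗-cong (≈-refl {Y}) (∘ₚ-⟪⟫ 1F Y)) (≈-trans (⊗-comm Y 1ₚ) (⊗-identityˡ Y)))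

  ∘ₚ-sumₚ : ∀ {I : Set} (f : I → Pol) is Y → sumₚ (map f is) ∘ₚ Y ≈ sumₚ (map (λ i → f i ∘ₚ Y) is)
  ∘ₚ-sumₚ f []       Y = ≈-refl
  ∘ₚ-sumₚ f (i ∷ is) Y = ≈-trans (∘ₚ-⊕ (f i) _ Y) (⊕-cong (≈-refl {f i ∘ₚ Y}) (∘ₚ-sumₚ f is Y))

  -- If the first m coefficients of P vanish, then P = 𝕏 ^ m ⊗ drop m P, and we substitute Y for 𝕏.
  ∘ₚ-lowZeros : ∀ m P Y → (∀ j → j < m → coeff P j ≡ 0F) → P ∘ₚ Y ≈ Y ^ m ⊗ drop m P ∘ₚ Y
  ∘ₚ-lowZeros zero    P       Y z = ≈-sym (⊗-identityˡ (P ∘ₚ Y))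
  ∘ₚ-lowZeros (suc m) []      Y z = ≈-sym (⊗-zeroʳ (Y ^ suc m))
  ∘ₚ-lowZeros (suc m) (a ∷ P) Y z = begin
    ⟪ a ⟫ ⊕ Y ⊗ P ∘ₚ Y                    ≈⟨ ⊕-cong (≈-trans (∷-cong (z 0 (s≤s z≤n)) ≈-refl) ⟪0⟫≈[]) ≈-refl ⟩
    Y ⊗ P ∘ₚ Y                            ≈⟨ ⊗-cong (≈-refl {Y}) (∘ₚ-lowZeros m P Y (λ j j<m → z (suc j) (s≤s j<m))) ⟩
    Y ⊗ (Y ^ m ⊗ drop m P ∘ₚ Y)           ≈⟨ ⊗-assoc Y (Y ^ m) (drop m P ∘ₚ Y) ⟨
    Y ^ suc m ⊗ drop (suc m) (a ∷ P) ∘ₚ Y ∎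
    where open ≈-Reasoning

  coeff-𝕏+⊗ : ∀ c R j → coeff (𝕏+ c ⊗ R) j ≡ c *F coeff R j +F coeff (0F ∷ R) j
  coeff-𝕏+⊗ c R j = trans (coeff-⊕ ((0F +F c) • R) (0F ∷ 1ₚ ⊗ R) j)
    (cong₂ _+F_ (trans (coeff-• (0F +F c) R j) (cong (_*F coeff R j) (+-identityˡ c)))
                (coeff≡ (∷-cong refl (⊗-identityˡ R)) j))

  private
    pascal-shift : ∀ c N j → c *F ([ N C suc j ] *F c ^F (N ∸ suc j)) ≡ [ N C suc j ] *F c ^F (N ∸ j)
    pascal-shift c N j with ℕₚ.<-≤-connex j N
    ... | inj₁ j<N = trans (*-swap c [ N C suc j ] (c ^F (N ∸ suc j)))
                           (cong (λ e → [ N C suc j ] *F c ^F e) (sym (ℕₚ.+-∸-assoc 1 j<N)))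
    ... | inj₂ N≤j = begin
      c *F ([ N C suc j ] *F c ^F (N ∸ suc j)) ≡⟨ cong (λ u → c *F ([ u ] *F c ^F (N ∸ suc j))) N<1+j ⟩
      c *F (0F *F c ^F (N ∸ suc j))            ≡⟨ trans (cong (c *F_) (zeroˡ _)) (zeroʳ c) ⟩
      0F                                        ≡⟨ zeroˡ (c ^F (N ∸ j)) ⟨
      0F *F c ^F (N ∸ j)                        ≡⟨ cong (λ u → [ u ] *F c ^F (N ∸ j)) N<1+j ⟨
      [ N C suc j ] *F c ^F (N ∸ j)             ∎
      where open ≡-Reasoning
            N<1+j = k>n⇒nCk≡0 (s≤s N≤j)

  coeff-𝕏+^ : ∀ c N j → coeff (𝕏+ c ^ N) j ≡ [ N C j ] *F c ^F (N ∸ j)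
  coeff-𝕏+^ c zero    zero    = sym (*-identityˡ 1F)
  coeff-𝕏+^ c zero    (suc j) = sym (zeroˡ 1F)
  coeff-𝕏+^ c (suc N) zero    = trans (coeff-𝕏+⊗ c (𝕏+ c ^ N) zero)
    (trans (+-identityʳ _) (trans (cong (c *F_) (coeff-𝕏+^ c N zero)) (*-swap c [ 1 ] (c ^F N))))
  coeff-𝕏+^ c (suc N) (suc j) = begin
    coeff (𝕏+ c ^ suc N) (suc j)                                   ≡⟨ coeff-𝕏+⊗ c (𝕏+ c ^ N) (suc j) ⟩
    c *F coeff (𝕏+ c ^ N) (suc j) +F coeff (𝕏+ c ^ N) j            ≡⟨ cong₂ (λ u v → c *F u +F v)
                                                                         (coeff-𝕏+^ c N (suc j)) (coeff-𝕏+^ c N j) ⟩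
    c *F ([ N C suc j ] *F c ^F (N ∸ suc j)) +F [ N C j ] *F c ^F (N ∸ j)
                                                                   ≡⟨ cong (_+F [ N C j ] *F c ^F (N ∸ j)) (pascal-shift c N j) ⟩
    [ N C suc j ] *F c ^F (N ∸ j) +F [ N C j ] *F c ^F (N ∸ j)     ≡⟨ *-distribʳ-+ (c ^F (N ∸ j)) [ N C suc j ] [ N C j ] ⟨
    ([ N C suc j ] +F [ N C j ]) *F c ^F (N ∸ j)                   ≡⟨ cong (_*F c ^F (N ∸ j)) ([+] (N C suc j) (N C j)) ⟨
    [ N C suc j + N C j ] *F c ^F (N ∸ j)                          ≡⟨ cong (λ u → [ u ] *F c ^F (N ∸ j))
                                                                         (trans (ℕₚ.+-comm (N C suc j) (N C j)) (nCk+nC[k+1]≡[n+1]C[k+1] N j)) ⟩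
    [ suc N C suc j ] *F c ^F (N ∸ j)                              ∎
    where open ≡-Reasoning

module PrimeDivisibility {p : ℕ} (p-prime : Prime p) where
  open Combinatorics using (_C_; k![n∸k]!∣n!)
  open import Data.Nat.Combinatorics.Specification using (nCk≡n!/k![n-k]!)

  1<p : 1 < p
  1<p = nonTrivial⇒n>1 p {{prime⇒nonTrivial p-prime}}

  ∣∧<⇒≡0 : ∀ {m} → p ∣ m → m < p → m ≡ 0
  ∣∧<⇒≡0 {zero}  _   _   = refl
  ∣∧<⇒≡0 {suc m} p∣m m<p = ⊥-elim (ℕₚ.<⇒≱ m<p (∣⇒≤ p∣m))

  ∤! : ∀ m → m < p → ¬ p ∣ m !
  ∤! zero    _   p∣1 = ℕₚ.<⇒≢ 1<p (sym (∣1⇒≡1 p∣1))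
  ∤! (suc m) m<p p∣m! with euclidsLemma (suc m) (m !) p-prime p∣m!
  ... | inj₁ p∣1+m = ℕₚ.1+n≢0 (∣∧<⇒≡0 p∣1+m m<p)
  ... | inj₂ p∣m!  = ∤! m (ℕₚ.<-trans (ℕₚ.n<1+n m) m<p) p∣m!

  -- p ∣ p! = (p C k) · k! · (p ∸ k)!, and p divides neither factorial.
  ∣C : ∀ k → 0 < k → k < p → p ∣ p C k
  ∣C k 0<k k<p with euclidsLemma (p C k) (k ! * (p ∸ k) !) p-prime p∣product
    where
      instance _ = k ℕₚ.!* (p ∸ k) !≢0
      p∣p! : p ∣ p !
      p∣p! = subst (λ m → m ∣ m !) (ℕₚ.suc-pred p {{>-nonZero (ℕₚ.<-trans (s≤s z≤n) 1<p)}}) (m∣m*n _)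
      p∣product : p ∣ (p C k) * (k ! * (p ∸ k) !)
      p∣product = subst (p ∣_) (sym (trans (cong (_* (k ! * (p ∸ k) !)) (nCk≡n!/k![n-k]! (ℕₚ.<⇒≤ k<p)))
                                           (m/n*n≡m (k![n∸k]!∣n! (ℕₚ.<⇒≤ k<p))))) p∣p!
  ... | inj₁ p∣C = p∣C
  ... | inj₂ p∣k![p∸k]! with euclidsLemma (k !) ((p ∸ k) !) p-prime p∣k![p∸k]!
  ...   | inj₁ p∣k!     = ⊥-elim (∤! k k<p p∣k!)
  ...   | inj₂ p∣[p∸k]! = ⊥-elim (∤! (p ∸ k) (ℕₚ.∸-monoʳ-< 0<k (ℕₚ.<⇒≤ k<p)) p∣[p∸k]!)

module PrimeField (p : ℕ) .{{_ : NonZero p}} (p-prime : Prime p) where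
  open Combinatorics using (_C_)
  open Fp p
  open Residue p
  open Polynomial p
  open PrimeDivisibility p-prime

  p∣⇒[]≡0F : ∀ n → p ∣ n → [ n ] ≡ 0F
  p∣⇒[]≡0F n p∣n = toℕ-injective (trans (toℕ-[] n) (trans (n∣m⇒m%n≡0 n p p∣n) (sym toℕ-0F)))

  []≡0F⇒p∣ : ∀ n → [ n ] ≡ 0F → p ∣ n
  []≡0F⇒p∣ n e = m%n≡0⇒n∣m n p (trans (sym (toℕ-[] n)) (trans (cong toℕ e) toℕ-0F))

  p∣toℕ⇒≡0F : ∀ a → p ∣ toℕ a → a ≡ 0F
  p∣toℕ⇒≡0F a p∣a = toℕ-injective (trans (∣∧<⇒≡0 p∣a (toℕ<n a)) (sym toℕ-0F))

  1F≢0F : ¬ 1F ≡ 0F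
  1F≢0F e = ℕₚ.1+n≢0 (trans (sym (trans (toℕ-[] 1) (m<n⇒m%n≡m 1<p))) (trans (cong toℕ e) toℕ-0F))

  *-integral : ∀ a b → a *F b ≡ 0F → a ≡ 0F ⊎ b ≡ 0F
  *-integral a b ab≡0 with euclidsLemma (toℕ a) (toℕ b) p-prime ([]≡0F⇒p∣ _ ab≡0)
  ... | inj₁ p∣a = inj₁ (p∣toℕ⇒≡0F a p∣a)
  ... | inj₂ p∣b = inj₂ (p∣toℕ⇒≡0F b p∣b)

  *-cancel-nonzeroˡ : ∀ {a b} → ¬ a ≡ 0F → a *F b ≡ 0F → b ≡ 0F
  *-cancel-nonzeroˡ a≢0 ab≡0 with *-integral _ _ ab≡0
  ... | inj₁ a≡0 = ⊥-elim (a≢0 a≡0)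
  ... | inj₂ b≡0 = b≡0

  *-nonzero : ∀ {a b} → ¬ a ≡ 0F → ¬ b ≡ 0F → ¬ a *F b ≡ 0F
  *-nonzero a≢0 b≢0 ab≡0 = b≢0 (*-cancel-nonzeroˡ a≢0 ab≡0)

  ^F-nonzero : ∀ {a} n → ¬ a ≡ 0F → ¬ a ^F n ≡ 0F
  ^F-nonzero zero    a≢0 = 1F≢0F
  ^F-nonzero (suc n) a≢0 = *-nonzero a≢0 (^F-nonzero n a≢0)

  *-cancelˡ : ∀ {a x y} → ¬ a ≡ 0F → a *F x ≡ a *F y → x ≡ y
  *-cancelˡ {a} {x} {y} a≢0 ax≡ay = x∙y⁻¹≈ε⇒x≈y x y (*-cancel-nonzeroˡ a≢0 (begin
    a *F (x -F y)            ≡⟨ distribˡ a x (-F y) ⟩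
    a *F x +F a *F (-F y)    ≡⟨ cong₂ _+F_ ax≡ay (sym (-‿distribʳ-* a y)) ⟩
    a *F y -F a *F y         ≡⟨ -‿inverseʳ (a *F y) ⟩
    0F                       ∎))
    where open ≡-Reasoning

  1^F : ∀ n → 1F ^F n ≡ 1F
  1^F zero    = refl
  1^F (suc n) = trans (cong (1F *F_) (1^F n)) (*-identityˡ 1F)

  p≡1+[p∸1] : p ≡ suc (p ∸ 1)
  p≡1+[p∸1] = sym (ℕₚ.m+[n∸m]≡n (ℕₚ.<⇒≤ 1<p))

  0^Fp : 0F ^F p ≡ 0F
  0^Fp = trans (cong (0F ^F_) p≡1+[p∸1]) (zeroˡ (0F ^F (p ∸ 1)))

  -- Only the two extreme binomial coefficients of (X + 1)^p survive modulo p.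
  frobenius-coeff : ∀ j → [ p C j ] *F 1F ^F (p ∸ j) ≡ coeff 1ₚ j +F [ p C j ] *F 0F ^F (p ∸ j)
  frobenius-coeff zero = begin
    [ p C 0 ] *F 1F ^F p      ≡⟨ trans (cong ([ 1 ] *F_) (1^F p)) (*-identityˡ 1F) ⟩
    1F                        ≡⟨ +-identityʳ 1F ⟨
    1F +F 0F                  ≡⟨ cong (1F +F_) (trans (cong ([ 1 ] *F_) 0^Fp) (zeroʳ [ 1 ])) ⟨
    1F +F [ p C 0 ] *F 0F ^F p ∎
    where open ≡-Reasoning
  frobenius-coeff (suc j) with ℕₚ.<-≤-connex (suc j) p
  ... | inj₁ j<p = begin
    [ p C suc j ] *F 1F ^F (p ∸ suc j)        ≡⟨ cong (_*F 1F ^F (p ∸ suc j)) pCj≡0 ⟩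
    0F *F 1F ^F (p ∸ suc j)                   ≡⟨ zeroˡ _ ⟩
    0F                                        ≡⟨ zeroˡ _ ⟨
    0F *F 0F ^F (p ∸ suc j)                   ≡⟨ cong (_*F 0F ^F (p ∸ suc j)) pCj≡0 ⟨
    [ p C suc j ] *F 0F ^F (p ∸ suc j)        ≡⟨ +-identityˡ _ ⟨
    0F +F [ p C suc j ] *F 0F ^F (p ∸ suc j)  ∎
    where open ≡-Reasoning
          pCj≡0 = p∣⇒[]≡0F _ (∣C (suc j) (s≤s z≤n) j<p)
  ... | inj₂ p≤j = trans (cong (λ e → [ p C suc j ] *F 1F ^F e) (ℕₚ.m≤n⇒m∸n≡0 p≤j))
    (sym (trans (+-identityˡ _) (cong (λ e → [ p C suc j ] *F 0F ^F e) (ℕₚ.m≤n⇒m∸n≡0 p≤j))))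

  frobeniusₚ : 𝕏+ 1F ^ p ≈ 1ₚ ⊕ 𝕏+ 0F ^ p
  frobeniusₚ = mk≈ λ j → begin
    coeff (𝕏+ 1F ^ p) j                              ≡⟨ coeff-𝕏+^ 1F p j ⟩
    [ p C j ] *F 1F ^F (p ∸ j)                       ≡⟨ frobenius-coeff j ⟩
    coeff 1ₚ j +F [ p C j ] *F 0F ^F (p ∸ j)         ≡⟨ cong (coeff 1ₚ j +F_) (coeff-𝕏+^ 0F p j) ⟨
    coeff 1ₚ j +F coeff (𝕏+ 0F ^ p) j                ≡⟨ coeff-⊕ 1ₚ (𝕏+ 0F ^ p) j ⟨
    coeff (1ₚ ⊕ 𝕏+ 0F ^ p) j                         ∎
    where open ≡-Reasoning

  frobenius : ∀ x → (x +F 1F) ^F p ≡ 1F +F x ^F p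
  frobenius x = begin
    (x +F 1F) ^F p                       ≡⟨ trans (eval-^ (𝕏+ 1F) p x) (cong (_^F p) (eval-𝕏+ 1F x)) ⟨
    eval (𝕏+ 1F ^ p) x                   ≡⟨ eval-cong x frobeniusₚ ⟩
    eval (1ₚ ⊕ 𝕏+ 0F ^ p) x              ≡⟨ eval-⊕ 1ₚ (𝕏+ 0F ^ p) x ⟩
    eval 1ₚ x +F eval (𝕏+ 0F ^ p) x      ≡⟨ cong₂ _+F_ (eval-⟪⟫ 1F x)
                                             (trans (eval-^ (𝕏+ 0F) p x) (cong (_^F p) (trans (eval-𝕏+ 0F x) (+-identityʳ x)))) ⟩
    1F +F x ^F p                         ∎
    where open ≡-Reasoning

  fermat : ∀ a → a ^F p ≡ a
  fermat a = trans (cong (_^F p) (sym ([toℕ] a))) (trans (fermat-[] (toℕ a)) ([toℕ] a))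
    where
      fermat-[] : ∀ n → [ n ] ^F p ≡ [ n ]
      fermat-[] zero    = 0^Fp
      fermat-[] (suc n) = begin
        [ suc n ] ^F p        ≡⟨ cong (_^F p) [1+n] ⟩
        ([ n ] +F 1F) ^F p    ≡⟨ frobenius [ n ] ⟩
        1F +F [ n ] ^F p      ≡⟨ cong (1F +F_) (fermat-[] n) ⟩
        1F +F [ n ]           ≡⟨ +-comm 1F [ n ] ⟩
        [ n ] +F 1F           ≡⟨ [1+n] ⟨
        [ suc n ]             ∎
        where open ≡-Reasoning
              [1+n] : [ suc n ] ≡ [ n ] +F 1F
              [1+n] = trans (cong [_] (ℕₚ.+-comm 1 n)) ([+] n 1)

  invF-inverseˡ : ∀ {a} → ¬ a ≡ 0F → invF a *F a ≡ 1F
  invF-inverseˡ {a} a≢0 = *-cancelˡ a≢0 (begin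
    a *F (invF a *F a)     ≡⟨ cong (a *F_) (*-comm (invF a) a) ⟩
    a *F (a *F invF a)     ≡⟨ cong (λ e → a ^F e) p≡2+[p∸2] ⟨
    a ^F p                 ≡⟨ fermat a ⟩
    a                      ≡⟨ *-identityʳ a ⟨
    a *F 1F                ∎)
    where open ≡-Reasoning
          p≡2+[p∸2] : p ≡ suc (suc (p ∸ 2))
          p≡2+[p∸2] = sym (ℕₚ.m+[n∸m]≡n 1<p)

  prodF-invF : ∀ (h : F → F) L → All (λ c → ¬ h c ≡ 0F) L → prodF (map (λ c → invF (h c)) L) *F prodF (map h L) ≡ 1F
  prodF-invF h []      []           = *-identityˡ 1F
  prodF-invF h (c ∷ L) (hc≢0 ∷ hL≢0) = begin
    (invF (h c) *F I) *F (h c *F H)     ≡⟨ *-assoc (invF (h c)) I (h c *F H) ⟩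
    invF (h c) *F (I *F (h c *F H))     ≡⟨ cong (invF (h c) *F_) (*-swap I (h c) H) ⟩
    invF (h c) *F (h c *F (I *F H))     ≡⟨ *-assoc (invF (h c)) (h c) (I *F H) ⟨
    (invF (h c) *F h c) *F (I *F H)     ≡⟨ cong₂ _*F_ (invF-inverseˡ hc≢0) (prodF-invF h L hL≢0) ⟩
    1F *F 1F                            ≡⟨ *-identityˡ 1F ⟩
    1F                                  ∎
    where open ≡-Reasoning
          I = prodF (map (λ c → invF (h c)) L)
          H = prodF (map h L)

module Division (p : ℕ) .{{_ : NonZero p}} (p-prime : Prime p) where
  open Fp p
  open Residue p
  open Polynomial p
  open PrimeField p p-prime
  open import Algebra.Properties.Ring (CommutativeRing.ring commutativeRingₚ)
    using () renaming (-‿distribʳ-* to -ₚ‿distribʳ-⊗)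

  -- Synthetic division by X - b: the coefficients of the quotient are the values at b of the tails of P.
  quotient : F → Pol → Pol
  quotient b []      = []
  quotient b (a ∷ P) = eval P b ∷ quotient b P

  division : ∀ b P → P ≈ 𝕏- b ⊗ quotient b P ⊕ ⟪ eval P b ⟫
  division b []      = ≈-sym (⊕-cong (⊗-zeroʳ (𝕏- b)) ⟪0⟫≈[])
  division b (a ∷ P) = ∷-cong (sym constant) higher
    where
      r = eval P b
      q = quotient b P
      constant : ((-F b) *F r +F 0F) +F (a +F b *F r) ≡ a
      constant = begin
        ((-F b) *F r +F 0F) +F (a +F b *F r) ≡⟨ cong (_+F (a +F b *F r)) (trans (+-identityʳ _) (sym (-‿distribˡ-* b r))) ⟩
        (-F (b *F r)) +F (a +F b *F r)       ≡⟨ +-swap (-F (b *F r)) a (b *F r) ⟩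
        a +F ((-F (b *F r)) +F b *F r)       ≡⟨ cong (a +F_) (-‿inverseˡ (b *F r)) ⟩
        a +F 0F                              ≡⟨ +-identityʳ a ⟩
        a                                    ∎
        where open ≡-Reasoning
      higher : P ≈ ((-F b) • q ⊕ 1ₚ ⊗ (r ∷ q)) ⊕ []
      higher = begin
        P                                    ≈⟨ division b P ⟩
        𝕏- b ⊗ q ⊕ ⟪ r ⟫                     ≈⟨ ⊕-cong (𝕏-⊗ b q) (≈-refl {⟪ r ⟫}) ⟩
        ((-F b) • q ⊕ (0F ∷ q)) ⊕ ⟪ r ⟫      ≈⟨ ⊕-assoc ((-F b) • q) (0F ∷ q) ⟪ r ⟫ ⟩
        (-F b) • q ⊕ ((0F ∷ q) ⊕ ⟪ r ⟫)      ≈⟨ ⊕-cong (≈-refl {(-F b) • q}) (∷-cong (+-identityˡ r) (⊕-identityʳ q)) ⟩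
        (-F b) • q ⊕ (r ∷ q)                 ≈⟨ ⊕-cong (≈-refl {(-F b) • q}) (⊗-identityˡ (r ∷ q)) ⟨
        (-F b) • q ⊕ 1ₚ ⊗ (r ∷ q)            ≈⟨ ⊕-identityʳ _ ⟨
        ((-F b) • q ⊕ 1ₚ ⊗ (r ∷ q)) ⊕ []     ∎
        where open ≈-Reasoning

  factor-theorem : ∀ b P → eval P b ≡ 0F → P ≈ 𝕏- b ⊗ quotient b P
  factor-theorem b P Pb≡0 = ≈-trans (division b P)
    (≈-trans (⊕-cong (≈-refl {𝕏- b ⊗ quotient b P}) (≈-trans (∷-cong Pb≡0 ≈-refl) ⟪0⟫≈[])) (⊕-identityʳ _))

  𝕏-⊗≈[] : ∀ b W → 𝕏- b ⊗ W ≈ [] → W ≈ []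
  𝕏-⊗≈[] b W e with b ≟ 0F
  ... | yes refl = mk≈ λ k → begin
    coeff W k                                     ≡⟨ +-identityˡ (coeff W k) ⟨
    0F +F coeff W k                               ≡⟨ cong (_+F coeff W k) (trans (cong (_*F coeff W (suc k)) -0#≈0#) (zeroˡ _)) ⟨
    (-F 0F) *F coeff W (suc k) +F coeff W k       ≡⟨ coeff-𝕏-⊗-suc 0F W k ⟨
    coeff (𝕏- 0F ⊗ W) (suc k)                     ≡⟨ coeff≡ e (suc k) ⟩
    0F                                            ∎
    where open ≡-Reasoning
  ... | no b≢0 = mk≈ Wₖ≡0
    where
      -b≢0 : ¬ (-F b) ≡ 0F
      -b≢0 -b≡0 = b≢0 (trans (sym (-‿involutive b)) (trans (cong (λ u → -F u) -b≡0) -0#≈0#))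
      -- the coefficients of (X - b) W are -b W₀ and -b Wₖ₊₁ + Wₖ, so all Wₖ vanish in turn
      Wₖ≡0 : ∀ k → coeff W k ≡ 0F
      Wₖ≡0 zero    = *-cancel-nonzeroˡ -b≢0 (trans (sym (coeff-𝕏-⊗-zero b W)) (coeff≡ e 0))
      Wₖ≡0 (suc k) = *-cancel-nonzeroˡ -b≢0 (trans (sym (+-identityʳ _))
        (trans (cong ((-F b) *F coeff W (suc k) +F_) (sym (Wₖ≡0 k)))
               (trans (sym (coeff-𝕏-⊗-suc b W k)) (coeff≡ e (suc k)))))

  𝕏-⊗-cancelˡ : ∀ b U V → 𝕏- b ⊗ U ≈ 𝕏- b ⊗ V → U ≈ V
  𝕏-⊗-cancelˡ b U V e = mk≈ λ k → x∙y⁻¹≈ε⇒x≈y (coeff U k) (coeff V k)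
    (trans (cong (coeff U k +F_) (sym (coeff--ₚ V k)))
      (trans (sym (coeff-⊕ U (-ₚ V) k)) (coeff≡ (𝕏-⊗≈[] b (U ⊕ -ₚ V) b[U-V]≈[]) k)))
    where
      b[U-V]≈[] : 𝕏- b ⊗ (U ⊕ -ₚ V) ≈ []
      b[U-V]≈[] = begin
        𝕏- b ⊗ (U ⊕ -ₚ V)                ≈⟨ ⊗-distribˡ (𝕏- b) U (-ₚ V) ⟩
        𝕏- b ⊗ U ⊕ 𝕏- b ⊗ -ₚ V           ≈⟨ ⊕-cong e (≈-sym (-ₚ‿distribʳ-⊗ (𝕏- b) V)) ⟩
        𝕏- b ⊗ V ⊕ -ₚ (𝕏- b ⊗ V)         ≈⟨ ⊕-inverseʳ (𝕏- b ⊗ V) ⟩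
        []                               ∎
        where open ≈-Reasoning

  infix 4 _∣ₚ_
  _∣ₚ_ : Pol → Pol → Set
  D ∣ₚ P = Σ Pol λ T → P ≈ D ⊗ T

  eval-𝕏-^suc⊗ : ∀ b n R → eval (𝕏- b ^ suc n ⊗ R) b ≡ 0F
  eval-𝕏-^suc⊗ b n R = begin
    eval (𝕏- b ^ suc n ⊗ R) b                            ≡⟨ eval-⊗ (𝕏- b ^ suc n) R b ⟩
    eval (𝕏- b ⊗ 𝕏- b ^ n) b *F eval R b                 ≡⟨ cong (_*F eval R b) (eval-⊗ (𝕏- b) (𝕏- b ^ n) b) ⟩
    (eval (𝕏- b) b *F eval (𝕏- b ^ n) b) *F eval R b     ≡⟨ cong (λ u → (u *F eval (𝕏- b ^ n) b) *F eval R b)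
                                                              (trans (eval-𝕏- b b) (-‿inverseʳ b)) ⟩
    (0F *F eval (𝕏- b ^ n) b) *F eval R b                ≡⟨ trans (cong (_*F eval R b) (zeroˡ _)) (zeroˡ _) ⟩
    0F                                                   ∎
    where open ≡-Reasoning

  𝕏-^∣⊗⇒∣ : ∀ b n Q S → ¬ eval Q b ≡ 0F → 𝕏- b ^ n ∣ₚ Q ⊗ S → 𝕏- b ^ n ∣ₚ S
  𝕏-^∣⊗⇒∣ b zero    Q S Qb≢0 _       = S , ≈-sym (⊗-identityˡ S)
  𝕏-^∣⊗⇒∣ b (suc n) Q S Qb≢0 (R , e) =
    let (T , S′≈) = 𝕏-^∣⊗⇒∣ b n Q S′ Qb≢0 (R , 𝕏-⊗-cancelˡ b (Q ⊗ S′) (𝕏- b ^ n ⊗ R) cancel)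
    in T , ≈-trans S≈ (≈-trans (⊗-cong (≈-refl {𝕏- b}) S′≈) (≈-sym (⊗-assoc (𝕏- b) (𝕏- b ^ n) T)))
    where
      Sb≡0 : eval S b ≡ 0F
      Sb≡0 = *-cancel-nonzeroˡ Qb≢0
        (trans (sym (eval-⊗ Q S b)) (trans (eval-cong b e) (eval-𝕏-^suc⊗ b n R)))
      S′ = quotient b S
      S≈ : S ≈ 𝕏- b ⊗ S′
      S≈ = factor-theorem b S Sb≡0
      cancel : 𝕏- b ⊗ (Q ⊗ S′) ≈ 𝕏- b ⊗ (𝕏- b ^ n ⊗ R)
      cancel = begin
        𝕏- b ⊗ (Q ⊗ S′)        ≈⟨ ⊗-swap (𝕏- b) Q S′ ⟩
        Q ⊗ (𝕏- b ⊗ S′)        ≈⟨ ⊗-cong (≈-refl {Q}) S≈ ⟨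
        Q ⊗ S                  ≈⟨ e ⟩
        𝕏- b ^ suc n ⊗ R       ≈⟨ ⊗-assoc (𝕏- b) (𝕏- b ^ n) R ⟩
        𝕏- b ⊗ (𝕏- b ^ n ⊗ R)  ∎
        where open ≈-Reasoning

  eval-rootProduct-nonzero : ∀ m x B → All (λ b → ¬ x ≡ b) B → ¬ eval (rootProduct m B) x ≡ 0F
  eval-rootProduct-nonzero m x []      []           = λ e → 1F≢0F (trans (sym (eval-⟪⟫ 1F x)) e)
  eval-rootProduct-nonzero m x (b ∷ B) (x≢b ∷ x∉B) e =
    *-nonzero (λ e′ → ^F-nonzero (m b) x-b≢0 (trans (sym (eval-^ (𝕏- b) (m b) x)) e′))
              (eval-rootProduct-nonzero m x B x∉B)
              (trans (sym (eval-⊗ (𝕏- b ^ m b) (rootProduct m B) x)) e)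
    where
      x-b≢0 : ¬ eval (𝕏- b) x ≡ 0F
      x-b≢0 e″ = x≢b (x∙y⁻¹≈ε⇒x≈y x b (trans (sym (eval-𝕏- b x)) e″))

  rootProduct-∣ : ∀ m B P → Unique B → (∀ b → b ∈ B → 𝕏- b ^ m b ∣ₚ P) → rootProduct m B ∣ₚ P
  rootProduct-∣ m []      P _           _   = P , ≈-sym (⊗-identityˡ P)
  rootProduct-∣ m (b ∷ B) P (b∉B ∷ uB) div∣ =
    let (S , P≈) = rootProduct-∣ m B P uB (λ c c∈B → div∣ c (there c∈B))
        (R , P≈′) = div∣ b (here refl)
        (T , S≈) = 𝕏-^∣⊗⇒∣ b (m b) (rootProduct m B) S (eval-rootProduct-nonzero m b B b∉B) (R , ≈-trans (≈-sym P≈) P≈′)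
    in T , (begin
      P                                                 ≈⟨ P≈ ⟩
      rootProduct m B ⊗ S                               ≈⟨ ⊗-cong (≈-refl {rootProduct m B}) S≈ ⟩
      rootProduct m B ⊗ (𝕏- b ^ m b ⊗ T)                ≈⟨ ⊗-swap (rootProduct m B) (𝕏- b ^ m b) T ⟩
      𝕏- b ^ m b ⊗ (rootProduct m B ⊗ T)                ≈⟨ ⊗-assoc (𝕏- b ^ m b) (rootProduct m B) T ⟨
      rootProduct m (b ∷ B) ⊗ T                         ∎)
    where open ≈-Reasoning

  Deg≤ : ℕ → Pol → Set
  Deg≤ n P = ∀ k → n < k → coeff P k ≡ 0F

  Monic : ℕ → Pol → Set
  Monic n P = coeff P n ≡ 1F × Deg≤ n P

  Deg≤-cong : ∀ {n P Q} → P ≈ Q → Deg≤ n P → Deg≤ n Q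
  Deg≤-cong e deg k n<k = trans (sym (coeff≡ e k)) (deg k n<k)

  Deg≤-mono : ∀ {m n P} → m ≤ n → Deg≤ m P → Deg≤ n P
  Deg≤-mono m≤n deg k n<k = deg k (ℕₚ.<-≤-trans (s≤s m≤n) n<k)

  Deg≤-⊕ : ∀ {n} P Q → Deg≤ n P → Deg≤ n Q → Deg≤ n (P ⊕ Q)
  Deg≤-⊕ P Q degP degQ k n<k = trans (coeff-⊕ P Q k) (trans (cong₂ _+F_ (degP k n<k) (degQ k n<k)) (+-identityˡ 0F))

  Deg≤--ₚ : ∀ {n} P → Deg≤ n P → Deg≤ n (-ₚ P)
  Deg≤--ₚ P deg k n<k = trans (coeff--ₚ P k) (trans (cong (λ u → -F u) (deg k n<k)) -0#≈0#)

  Deg≤-• : ∀ {n} c P → Deg≤ n P → Deg≤ n (c • P)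
  Deg≤-• c P deg k n<k = trans (coeff-• c P k) (trans (cong (c *F_) (deg k n<k)) (zeroʳ c))

  Deg≤-sumₚ : ∀ {I : Set} {n} (f : I → Pol) is → (∀ i → i ∈ is → Deg≤ n (f i)) → Deg≤ n (sumₚ (map f is))
  Deg≤-sumₚ f []       _   k n<k = refl
  Deg≤-sumₚ f (i ∷ is) deg = Deg≤-⊕ (f i) _ (deg i (here refl)) (Deg≤-sumₚ f is (λ j j∈is → deg j (there j∈is)))

  Monic-cong : ∀ {n P Q} → P ≈ Q → Monic n P → Monic n Q
  Monic-cong e (lead , deg) = trans (sym (coeff≡ e _)) lead , Deg≤-cong e deg

  Monic-𝕏-⊗ : ∀ b n R → Monic n R → Monic (suc n) (𝕏- b ⊗ R)
  Monic-𝕏-⊗ b n R (lead , deg) = lead′ , deg′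
    where
      step : ∀ k → coeff R (suc k) ≡ 0F → (-F b) *F coeff R (suc k) +F coeff R k ≡ coeff R k
      step k Rₖ₊₁≡0 = trans (cong (λ u → (-F b) *F u +F coeff R k) Rₖ₊₁≡0)
                            (trans (cong (_+F coeff R k) (zeroʳ (-F b))) (+-identityˡ _))
      lead′ : coeff (𝕏- b ⊗ R) (suc n) ≡ 1F
      lead′ = trans (coeff-𝕏-⊗-suc b R n) (trans (step n (deg (suc n) ℕₚ.≤-refl)) lead)
      deg′ : Deg≤ (suc n) (𝕏- b ⊗ R)
      deg′ (suc k) (s≤s n<k) = trans (coeff-𝕏-⊗-suc b R k) (trans (step k (deg (suc k) (ℕₚ.m<n⇒m<1+n n<k))) (deg k n<k))

  Monic-𝕏-^⊗ : ∀ b k n R → Monic n R → Monic (k + n) (𝕏- b ^ k ⊗ R)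
  Monic-𝕏-^⊗ b zero    n R monic = Monic-cong (≈-sym (⊗-identityˡ R)) monic
  Monic-𝕏-^⊗ b (suc k) n R monic = Monic-cong (≈-sym (⊗-assoc (𝕏- b) (𝕏- b ^ k) R))
    (Monic-𝕏-⊗ b (k + n) (𝕏- b ^ k ⊗ R) (Monic-𝕏-^⊗ b k n R monic))

  Monic-rootProduct : ∀ m B → Monic (rootCount m B) (rootProduct m B)
  Monic-rootProduct m []      = refl , λ { (suc k) _ → refl }
  Monic-rootProduct m (b ∷ B) = Monic-𝕏-^⊗ b (m b) (rootCount m B) (rootProduct m B) (Monic-rootProduct m B)

  private
    coeff-⊗-∷-suc : ∀ Q s S k → coeff (Q ⊗ (s ∷ S)) (suc k) ≡ s *F coeff Q (suc k) +F coeff (Q ⊗ S) k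
    coeff-⊗-∷-suc Q s S k = trans (coeff≡ (⊗-∷ʳ Q s S) (suc k))
      (trans (coeff-⊕ (s • Q) (0F ∷ Q ⊗ S) (suc k)) (cong (_+F coeff (Q ⊗ S) k) (coeff-• s Q (suc k))))

    -- Above the degree n of Q, the coefficients of Q ⊗ (s ∷ S) are those of Q ⊗ S shifted by one.
    coeff-⊗-∷-high : ∀ n Q → Monic n Q → ∀ s S k → n ≤ k →
                     coeff (Q ⊗ (s ∷ S)) (suc k) ≡ 0F → coeff (Q ⊗ S) k ≡ 0F
    coeff-⊗-∷-high n Q (_ , deg) s S k n≤k z = begin
      coeff (Q ⊗ S) k                              ≡⟨ +-identityˡ _ ⟨
      0F +F coeff (Q ⊗ S) k                        ≡⟨ cong (_+F coeff (Q ⊗ S) k) (trans (cong (s *F_) (deg (suc k) (s≤s n≤k))) (zeroʳ s)) ⟨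
      s *F coeff Q (suc k) +F coeff (Q ⊗ S) k      ≡⟨ coeff-⊗-∷-suc Q s S k ⟨
      coeff (Q ⊗ (s ∷ S)) (suc k)                  ≡⟨ z ⟩
      0F                                           ∎
      where open ≡-Reasoning

    monic⊗-deg≤⇒constant : ∀ n Q → Monic n Q → ∀ S → Deg≤ n (Q ⊗ S) → ∀ k → coeff S (suc k) ≡ 0F
    monic⊗-deg≤⇒constant n Q monic []       _   k       = refl
    monic⊗-deg≤⇒constant n Q monic (s ∷ S′) deg zero    = begin
      coeff S′ 0                          ≡⟨ *-identityʳ _ ⟨
      coeff S′ 0 *F 1F                    ≡⟨ cong (coeff S′ 0 *F_) (proj₁ monic) ⟨
      coeff S′ 0 *F coeff Q n             ≡⟨ coeff-• (coeff S′ 0) Q n ⟨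
      coeff (coeff S′ 0 • Q) n            ≡⟨ coeff≡ QS′≈ n ⟨
      coeff (Q ⊗ S′) n                    ≡⟨ coeff-⊗-∷-high n Q monic s S′ n ℕₚ.≤-refl (deg (suc n) ℕₚ.≤-refl) ⟩
      0F                                  ∎
      where
        open ≡-Reasoning
        deg′ : Deg≤ n (Q ⊗ S′)
        deg′ k n<k = coeff-⊗-∷-high n Q monic s S′ k (ℕₚ.<⇒≤ n<k) (deg (suc k) (ℕₚ.m<n⇒m<1+n n<k))
        QS′≈ : Q ⊗ S′ ≈ coeff S′ 0 • Q
        QS′≈ = ≈-trans (⊗-cong (≈-refl {Q}) (mk≈ λ { zero → refl ; (suc k) → monic⊗-deg≤⇒constant n Q monic S′ deg′ k }))
                       (≈-trans (⊗-comm Q ⟪ coeff S′ 0 ⟫) (≈-sym (•≈⟪⟫⊗ (coeff S′ 0) Q)))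
    monic⊗-deg≤⇒constant n Q monic (s ∷ S′) deg (suc k) = monic⊗-deg≤⇒constant n Q monic S′ deg′ k
      where
        deg′ : Deg≤ n (Q ⊗ S′)
        deg′ k n<k = coeff-⊗-∷-high n Q monic s S′ k (ℕₚ.<⇒≤ n<k) (deg (suc k) (ℕₚ.m<n⇒m<1+n n<k))

  monic∣∧deg≤⇒≈• : ∀ n Q P → Monic n Q → Deg≤ n P → Q ∣ₚ P → Σ F λ c → P ≈ c • Q
  monic∣∧deg≤⇒≈• n Q P monic deg (S , P≈) = coeff S 0 , (begin
    P                        ≈⟨ P≈ ⟩
    Q ⊗ S                    ≈⟨ ⊗-cong (≈-refl {Q}) S≈ ⟩
    Q ⊗ ⟪ coeff S 0 ⟫        ≈⟨ ⊗-comm Q ⟪ coeff S 0 ⟫ ⟩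
    ⟪ coeff S 0 ⟫ ⊗ Q        ≈⟨ •≈⟪⟫⊗ (coeff S 0) Q ⟨
    coeff S 0 • Q            ∎)
    where
      open ≈-Reasoning
      S≈ : S ≈ ⟪ coeff S 0 ⟫
      S≈ = mk≈ λ { zero → refl ; (suc k) → monic⊗-deg≤⇒constant n Q monic S (Deg≤-cong P≈ deg) k }

module Interpolation (p : ℕ) .{{_ : NonZero p}} (p-prime : Prime p) where
  open Fp p
  open Residue p
  open Polynomial p
  open PrimeField p p-prime
  open Division p p-prime

  remove-∉ : ∀ a A → Unique A → All (λ c → ¬ a ≡ c) (remove a A)
  remove-∉ a []      _          = []
  remove-∉ a (x ∷ A) (a∉A ∷ uA) with a ≟ x
  ... | yes refl = a∉A
  ... | no a≢x   = a≢x ∷ remove-∉ a A uA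

  ∈-remove : ∀ {a c} A → c ∈ A → ¬ c ≡ a → c ∈ remove a A
  ∈-remove {a} (x ∷ A) c∈ c≢a with a ≟ x
  ∈-remove (x ∷ A) (here refl)  c≢a | yes refl = ⊥-elim (c≢a refl)
  ∈-remove (x ∷ A) (there c∈A)  c≢a | yes refl = c∈A
  ∈-remove (x ∷ A) (here refl)  c≢a | no _     = here refl
  ∈-remove (x ∷ A) (there c∈A)  c≢a | no _     = there (∈-remove A c∈A c≢a)

  length-remove : ∀ {a} A → a ∈ A → suc (length (remove a A)) ≡ length A
  length-remove {a} (x ∷ A) a∈ with a ≟ x
  length-remove (x ∷ A) _           | yes _   = refl
  length-remove (x ∷ A) (here refl) | no a≢x  = ⊥-elim (a≢x refl)
  length-remove (x ∷ A) (there a∈A) | no _    = cong suc (length-remove A a∈A)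

  nodePolynomial : List F → Pol
  nodePolynomial = rootProduct (λ _ → 1)

  rootCount-nodePolynomial : ∀ L → rootCount (λ _ → 1) L ≡ length L
  rootCount-nodePolynomial []      = refl
  rootCount-nodePolynomial (x ∷ L) = cong suc (rootCount-nodePolynomial L)

  eval-nodePolynomial : ∀ L x → eval (nodePolynomial L) x ≡ prodF (map (λ c → x -F c) L)
  eval-nodePolynomial []      x = eval-⟪⟫ 1F x
  eval-nodePolynomial (c ∷ L) x = trans (eval-⊗ (𝕏- c ^ 1) (nodePolynomial L) x)
    (cong₂ _*F_ (trans (eval-^ (𝕏- c) 1 x) (trans (*-identityʳ _) (eval-𝕏- c x))) (eval-nodePolynomial L x))

  lagrangeBasis : List F → F → Pol
  lagrangeBasis A a = coef A a • nodePolynomial (remove a A)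

  eval-lagrangeBasis-self : ∀ A a → Unique A → eval (lagrangeBasis A a) a ≡ 1F
  eval-lagrangeBasis-self A a uA = trans (eval-• (coef A a) (nodePolynomial (remove a A)) a)
    (trans (cong (coef A a *F_) (eval-nodePolynomial (remove a A) a))
           (prodF-invF (λ c → a -F c) (remove a A) (a-c≢0 (remove-∉ a A uA))))
    where
      a-c≢0 : ∀ {L} → All (λ c → ¬ a ≡ c) L → All (λ c → ¬ a -F c ≡ 0F) L
      a-c≢0 []            = []
      a-c≢0 (a≢c ∷ a∉L) = (λ e → a≢c (x∙y⁻¹≈ε⇒x≈y _ _ e)) ∷ a-c≢0 a∉L

  eval-lagrangeBasis-other : ∀ A a {c} → c ∈ A → ¬ c ≡ a → eval (lagrangeBasis A a) c ≡ 0F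
  eval-lagrangeBasis-other A a {c} c∈A c≢a = trans (eval-• (coef A a) (nodePolynomial (remove a A)) c)
    (trans (cong (coef A a *F_) (trans (eval-nodePolynomial (remove a A) c)
                                       (prodF-zero (λ c′ → c -F c′) (remove a A) (∈-remove A c∈A c≢a) (-‿inverseʳ c))))
           (zeroʳ (coef A a)))

  module _ (A : List F) (uA : Unique A) {n : ℕ} (lenA : length A ≡ suc n) where

    private
      rootCount-remove : ∀ {a} → a ∈ A → rootCount (λ _ → 1) (remove a A) ≡ n
      rootCount-remove {a} a∈A =
        ℕₚ.suc-injective (trans (cong suc (rootCount-nodePolynomial (remove a A))) (trans (length-remove A a∈A) lenA))

      Monic-lagrangeNode : ∀ {a} → a ∈ A → Monic n (nodePolynomial (remove a A))
      Monic-lagrangeNode {a} a∈A = subst (λ k → Monic k (nodePolynomial (remove a A))) (rootCount-remove a∈A)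
                                         (Monic-rootProduct (λ _ → 1) (remove a A))

      Monic-nodePolynomial : Monic (suc n) (nodePolynomial A)
      Monic-nodePolynomial = subst (λ k → Monic k (nodePolynomial A)) (trans (rootCount-nodePolynomial A) lenA)
                                   (Monic-rootProduct (λ _ → 1) A)

    Deg≤∧roots⇒≈[] : ∀ g → Deg≤ n g → (∀ a → a ∈ A → eval g a ≡ 0F) → g ≈ []
    Deg≤∧roots⇒≈[] g deg roots = ≈-trans g≈ (≈-trans (•-cong c≡0 ≈-refl) (0•P≈[] (nodePolynomial A)))
      where
        nodes∣g : nodePolynomial A ∣ₚ g
        nodes∣g = rootProduct-∣ (λ _ → 1) A g uA λ a a∈A →
          quotient a g , ≈-trans (factor-theorem a g (roots a a∈A)) (⊗-cong (≈-sym (⊗-identityʳ (𝕏- a))) ≈-refl)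
        scalar : Σ F λ c → g ≈ c • nodePolynomial A
        scalar = monic∣∧deg≤⇒≈• (suc n) (nodePolynomial A) g Monic-nodePolynomial (Deg≤-mono {P = g} (ℕₚ.n≤1+n n) deg) nodes∣g
        c = proj₁ scalar
        g≈ = proj₂ scalar
        c≡0 : c ≡ 0F
        c≡0 = begin
          c                                       ≡⟨ *-identityʳ c ⟨
          c *F 1F                                 ≡⟨ cong (c *F_) (proj₁ Monic-nodePolynomial) ⟨
          c *F coeff (nodePolynomial A) (suc n)   ≡⟨ coeff-• c (nodePolynomial A) (suc n) ⟨
          coeff (c • nodePolynomial A) (suc n)    ≡⟨ coeff≡ g≈ (suc n) ⟨
          coeff g (suc n)                         ≡⟨ deg (suc n) ℕₚ.≤-refl ⟩
          0F                                      ∎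
          where open ≡-Reasoning

    -- The Lagrange interpolant L of f on A is f itself, and its coefficient of x^n is Σ_a c_a(A) f(a).
    interpolation : ∀ f → Deg≤ n f → sumF (map (λ a → coef A a *F eval f a) A) ≡ coeff f n
    interpolation f deg = sym (trans (x∙y⁻¹≈ε⇒x≈y (coeff f n) (coeff L n) f-L≡0ₙ) coeff-L)
      where
        term : F → Pol
        term a = eval f a • lagrangeBasis A a

        L : Pol
        L = sumₚ (map term A)

        eval-L : ∀ c → c ∈ A → eval L c ≡ eval f c
        eval-L c c∈A = begin
          eval L c                                 ≡⟨ eval-sumₚ term A c ⟩
          sumF (map (λ a → eval (term a) c) A)      ≡⟨ sumF-single (λ a → eval (term a) c) A uA c∈A (λ a a∈A a≢c →
                                                        trans (eval-• (eval f a) (lagrangeBasis A a) c)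
                                                              (trans (cong (eval f a *F_) (eval-lagrangeBasis-other A a c∈A (λ c≡a → a≢c (sym c≡a))))
                                                                     (zeroʳ (eval f a)))) ⟩
          eval (term c) c                          ≡⟨ eval-• (eval f c) (lagrangeBasis A c) c ⟩
          eval f c *F eval (lagrangeBasis A c) c   ≡⟨ cong (eval f c *F_) (eval-lagrangeBasis-self A c uA) ⟩
          eval f c *F 1F                           ≡⟨ *-identityʳ (eval f c) ⟩
          eval f c                                 ∎
          where open ≡-Reasoning

        deg-L : Deg≤ n L
        deg-L = Deg≤-sumₚ term A (λ a a∈A → Deg≤-• (eval f a) (lagrangeBasis A a) (Deg≤-• (coef A a) (nodePolynomial (remove a A)) (proj₂ (Monic-lagrangeNode a∈A))))

        f-L≈[] : f ⊕ -ₚ L ≈ []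
        f-L≈[] = Deg≤∧roots⇒≈[] (f ⊕ -ₚ L) (Deg≤-⊕ f (-ₚ L) deg (Deg≤--ₚ L deg-L)) λ a a∈A →
          trans (eval-⊕ f (-ₚ L) a)
                (trans (cong (eval f a +F_) (trans (eval--ₚ L a) (cong (λ u → -F u) (eval-L a a∈A)))) (-‿inverseʳ (eval f a)))

        f-L≡0ₙ : coeff f n -F coeff L n ≡ 0F
        f-L≡0ₙ = trans (cong (coeff f n +F_) (sym (coeff--ₚ L n))) (trans (sym (coeff-⊕ f (-ₚ L) n)) (coeff≡ f-L≈[] n))

        coeff-L : coeff L n ≡ sumF (map (λ a → coef A a *F eval f a) A)
        coeff-L = trans (coeff-sumₚ term A n) (sumF-cong-∈ A λ a a∈A → begin
          coeff (eval f a • lagrangeBasis A a) n                       ≡⟨ coeff-• (eval f a) (lagrangeBasis A a) n ⟩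
          eval f a *F coeff (coef A a • nodePolynomial (remove a A)) n ≡⟨ cong (eval f a *F_) (coeff-• (coef A a) (nodePolynomial (remove a A)) n) ⟩
          eval f a *F (coef A a *F coeff (nodePolynomial (remove a A)) n)
                                                                       ≡⟨ cong (λ u → eval f a *F (coef A a *F u)) (proj₁ (Monic-lagrangeNode a∈A)) ⟩
          eval f a *F (coef A a *F 1F)                                 ≡⟨ cong (eval f a *F_) (*-identityʳ (coef A a)) ⟩
          eval f a *F coef A a                                         ≡⟨ *-comm (eval f a) (coef A a) ⟩
          coef A a *F eval f a                                         ∎)
          where open ≡-Reasoning

module HansonPetridis (p : ℕ) .{{_ : NonZero p}} (p-prime : Prime p)
                      (d : ℕ) (A B : List (Fp.F p)) (uA : Unique A) (uB : Unique B) (critical : Fp.Critical p d A B) where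
  open Fp p
  open Residue p
  open Polynomial p
  open PrimeField p p-prime
  open Division p p-prime
  open Interpolation p p-prime
  open Critical critical
  open Combinatorics using (_C_; k>n⇒nCk≡0; nCn≡1)
  open import Algebra.Properties.CommutativeSemigroup ℕₚ.+-commutativeSemigroup
    using () renaming (interchange to ℕ-interchange)

  n : ℕ
  n = length A ∸ 1

  lenA : length A ≡ suc n
  lenA with length A | sizeA
  ... | suc _ | _ = refl

  1≤n : 1 ≤ n
  1≤n = ℕₚ.≤-pred (subst (2 ≤_) lenA sizeA)

  N : ℕ
  N = d + length A ∸ 1

  N≡d+n : N ≡ d + n
  N≡d+n = trans (cong (λ l → d + l ∸ 1) lenA) (cong (_∸ 1) (ℕₚ.+-suc d n))

  -- Σ_a c_a (a + b)^k is the coefficient of x^n in (x + b)^k.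
  powerSum : ∀ b k → k ≤ n → sumF (map (λ a → coef A a *F (a +F b) ^F k) A) ≡ [ k C n ] *F b ^F (k ∸ n)
  powerSum b k k≤n = begin
    sumF (map (λ a → coef A a *F (a +F b) ^F k) A)         ≡⟨ sumF-cong A (λ a → cong (coef A a *F_) eval-𝕏+b^k) ⟨
    sumF (map (λ a → coef A a *F eval (𝕏+ b ^ k) a) A)     ≡⟨ interpolation A uA lenA (𝕏+ b ^ k) deg ⟩
    coeff (𝕏+ b ^ k) n                                     ≡⟨ coeff-𝕏+^ b k n ⟩
    [ k C n ] *F b ^F (k ∸ n)                              ∎
    where
      open ≡-Reasoning
      eval-𝕏+b^k : ∀ {a} → eval (𝕏+ b ^ k) a ≡ (a +F b) ^F k
      eval-𝕏+b^k {a} = trans (eval-^ (𝕏+ b) k a) (cong (_^F k) (eval-𝕏+ b a))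
      deg : Deg≤ n (𝕏+ b ^ k)
      deg j n<j = trans (coeff-𝕏+^ b k j)
        (trans (cong (λ u → [ u ] *F b ^F (k ∸ j)) (k>n⇒nCk≡0 (ℕₚ.≤-<-trans k≤n n<j))) (zeroˡ (b ^F (k ∸ j))))

  powerSum-low : ∀ b k → k < n → sumF (map (λ a → coef A a *F (a +F b) ^F k) A) ≡ 0F
  powerSum-low b k k<n = trans (powerSum b k (ℕₚ.<⇒≤ k<n))
    (trans (cong (λ u → [ u ] *F b ^F (k ∸ n)) (k>n⇒nCk≡0 k<n)) (zeroˡ (b ^F (k ∸ n))))

  powerSum-top : ∀ b → sumF (map (λ a → coef A a *F (a +F b) ^F n) A) ≡ 1F
  powerSum-top b = trans (powerSum b n ℕₚ.≤-refl)
    (trans (cong₂ (λ u v → [ u ] *F b ^F v) (nCn≡1 n) (ℕₚ.n∸n≡0 n)) (*-identityˡ 1F))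

  HPₚ : Pol
  HPₚ = sumₚ (map (λ a → coef A a • 𝕏+ a ^ N) A) ⊕ -ₚ 1ₚ

  shiftedHP : F → Pol
  shiftedHP b = sumₚ (map (λ a → coef A a • 𝕏+ (a +F b) ^ N) A) ⊕ -ₚ 1ₚ

  HPₚ≈shiftedHP0 : HPₚ ≈ shiftedHP 0F
  HPₚ≈shiftedHP0 = ≈-reflexive (cong (λ l → sumₚ l ⊕ -ₚ 1ₚ)
    (Listₚ.map-cong (λ a → cong (λ u → coef A a • 𝕏+ u ^ N) (sym (+-identityʳ a))) A))

  shiftedHP∘𝕏- : ∀ b → shiftedHP b ∘ₚ 𝕏- b ≈ HPₚ
  shiftedHP∘𝕏- b = ≈-trans (∘ₚ-⊕ (sumₚ (map term A)) (-ₚ 1ₚ) (𝕏- b))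
    (⊕-cong (≈-trans (∘ₚ-sumₚ term A (𝕏- b)) (sumₚ-cong A term∘𝕏-)) (∘ₚ-⟪⟫ (-F 1F) (𝕏- b)))
    where
      term : F → Pol
      term a = coef A a • 𝕏+ (a +F b) ^ N
      𝕏-b+[a+b] : ∀ a → 𝕏- b ⊕ ⟪ a +F b ⟫ ≈ 𝕏+ a
      𝕏-b+[a+b] a = ∷-cong (trans (+-swap (-F b) a b)
                              (trans (cong (a +F_) (-‿inverseˡ b)) (trans (+-identityʳ a) (sym (+-identityˡ a)))))
                            ≈-refl
      term∘𝕏- : ∀ a → term a ∘ₚ 𝕏- b ≈ coef A a • 𝕏+ a ^ N
      term∘𝕏- a = begin
        (coef A a • 𝕏+ (a +F b) ^ N) ∘ₚ 𝕏- b        ≈⟨ ∘ₚ-• (coef A a) (𝕏+ (a +F b) ^ N) (𝕏- b) ⟩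
        ⟪ coef A a ⟫ ⊗ (𝕏+ (a +F b) ^ N) ∘ₚ 𝕏- b     ≈⟨ ⊗-cong (≈-refl {⟪ coef A a ⟫}) (∘ₚ-^ (𝕏+ (a +F b)) N (𝕏- b)) ⟩
        ⟪ coef A a ⟫ ⊗ ((𝕏+ (a +F b)) ∘ₚ 𝕏- b) ^ N   ≈⟨ ⊗-cong (≈-refl {⟪ coef A a ⟫})
                                                         (^-cong N (≈-trans (∘ₚ-𝕏+ (a +F b) (𝕏- b)) (𝕏-b+[a+b] a))) ⟩
        ⟪ coef A a ⟫ ⊗ 𝕏+ a ^ N                      ≈⟨ •≈⟪⟫⊗ (coef A a) (𝕏+ a ^ N) ⟨
        coef A a • 𝕏+ a ^ N                          ∎
        where open ≈-Reasoning

  coeff-shiftedHP : ∀ b j → coeff (shiftedHP b) j ≡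
                    [ N C j ] *F sumF (map (λ a → coef A a *F (a +F b) ^F (N ∸ j)) A) -F coeff 1ₚ j
  coeff-shiftedHP b j = begin
    coeff (shiftedHP b) j                                                          ≡⟨ coeff-⊕ (sumₚ (map term A)) (-ₚ 1ₚ) j ⟩
    coeff (sumₚ (map term A)) j +F coeff (-ₚ 1ₚ) j                                 ≡⟨ cong₂ _+F_ (coeff-sumₚ term A j) (coeff--ₚ 1ₚ j) ⟩
    sumF (map (λ a → coeff (term a) j) A) -F coeff 1ₚ j                            ≡⟨ cong (_-F coeff 1ₚ j) (sumF-cong A λ a →
                                                                                        trans (coeff-• (coef A a) (𝕏+ (a +F b) ^ N) j)
                                                                                              (trans (cong (coef A a *F_) (coeff-𝕏+^ (a +F b) N j))
                                                                                                     (*-swap (coef A a) [ N C j ] _))) ⟩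
    sumF (map (λ a → [ N C j ] *F (coef A a *F (a +F b) ^F (N ∸ j))) A) -F coeff 1ₚ j ≡⟨ cong (_-F coeff 1ₚ j) (sumF-*ˡ [ N C j ] _ A) ⟩
    [ N C j ] *F sumF (map (λ a → coef A a *F (a +F b) ^F (N ∸ j)) A) -F coeff 1ₚ j  ∎
    where
      open ≡-Reasoning
      term : F → Pol
      term a = coef A a • 𝕏+ (a +F b) ^ N

  private
    m+n∸j<n : ∀ m {n j} → 1 ≤ n → m < j → m + n ∸ j < n
    m+n∸j<n zero    {suc n} {suc j} _   _         = s≤s (ℕₚ.m∸n≤m n j)
    m+n∸j<n (suc m) {n}     {suc j} 1≤n (s≤s m<j) = m+n∸j<n m 1≤n m<j

  Deg≤-HPₚ : Deg≤ d HPₚ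
  Deg≤-HPₚ = Deg≤-cong (≈-sym HPₚ≈shiftedHP0) λ { (suc j) d<1+j → begin
    coeff (shiftedHP 0F) (suc j)                                                   ≡⟨ coeff-shiftedHP 0F (suc j) ⟩
    [ N C suc j ] *F sumF (map (λ a → coef A a *F (a +F 0F) ^F (N ∸ suc j)) A) -F 0F
                                                                                   ≡⟨ cong₂ (λ u v → [ N C suc j ] *F u +F v)
                                                                                        (powerSum-low 0F (N ∸ suc j) (N∸1+j<n d<1+j)) -0#≈0# ⟩
    [ N C suc j ] *F 0F +F 0F                                                      ≡⟨ trans (+-identityʳ _) (zeroʳ [ N C suc j ]) ⟩
    0F                                                                             ∎ }
    where
      open ≡-Reasoning
      N∸1+j<n : ∀ {j} → d < suc j → N ∸ suc j < n
      N∸1+j<n {j} d<1+j = subst (λ u → u ∸ suc j < n) (sym N≡d+n) (m+n∸j<n d {n} {suc j} 1≤n d<1+j)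

  multiplicity : F → ℕ
  multiplicity b = length A ∸ eps A b

  eps≡1 : ∀ {b} → (-F b) ∈ A → eps A b ≡ 1
  eps≡1 {b} -b∈A with (-F b) ∈? A
  ... | yes _    = refl
  ... | no -b∉A = ⊥-elim (-b∉A -b∈A)

  eps≤1 : ∀ b → eps A b ≤ 1
  eps≤1 b with (-F b) ∈? A
  ... | yes _ = s≤s z≤n
  ... | no  _ = z≤n

  -- Below the multiplicity, the exponent N - j = d + (n - j) may be lowered to n - j: either a + b ∈ μ_d,
  -- or a + b = 0, in which case -b ∈ A lowers the multiplicity to n and 0^(n - j) = 0 on both sides.
  reduce-exponent : ∀ {a b j} → a ∈ A → b ∈ B → j < multiplicity b → (a +F b) ^F (N ∸ j) ≡ (a +F b) ^F (n ∸ j)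
  reduce-exponent {a} {b} {j} a∈A b∈B j<m =
    trans (cong ((a +F b) ^F_) N∸j≡d+[n∸j]) (trans (^F-+ (a +F b) d (n ∸ j)) (cases (sumset a∈A b∈B)))
    where
      j≤n : j ≤ n
      j≤n = ℕₚ.≤-pred (subst (suc j ≤_) lenA (ℕₚ.≤-trans j<m (ℕₚ.m∸n≤m (length A) (eps A b))))
      N∸j≡d+[n∸j] : N ∸ j ≡ d + (n ∸ j)
      N∸j≡d+[n∸j] = trans (cong (_∸ j) N≡d+n) (ℕₚ.+-∸-assoc d j≤n)
      cases : InMu d (a +F b) ⊎ a +F b ≡ 0F → (a +F b) ^F d *F (a +F b) ^F (n ∸ j) ≡ (a +F b) ^F (n ∸ j)
      cases (inj₁ μ) = trans (cong (_*F (a +F b) ^F (n ∸ j)) μ) (*-identityˡ _)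
      cases (inj₂ a+b≡0) = begin
        (a +F b) ^F d *F (a +F b) ^F (n ∸ j)   ≡⟨ cong (λ x → x ^F d *F x ^F (n ∸ j)) a+b≡0 ⟩
        0F ^F d *F 0F ^F (n ∸ j)               ≡⟨ cong (0F ^F d *F_) (0^F-pos (n ∸ j) 0<n∸j) ⟩
        0F ^F d *F 0F                          ≡⟨ zeroʳ (0F ^F d) ⟩
        0F                                     ≡⟨ 0^F-pos (n ∸ j) 0<n∸j ⟨
        0F ^F (n ∸ j)                          ≡⟨ cong (_^F (n ∸ j)) a+b≡0 ⟨
        (a +F b) ^F (n ∸ j)                    ∎
        where
          open ≡-Reasoning
          0^F-pos : ∀ k → 0 < k → 0F ^F k ≡ 0F
          0^F-pos (suc k) _ = zeroˡ (0F ^F k)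
          j<n : j < n
          j<n = subst (j <_) (trans (cong (length A ∸_) (eps≡1 (subst (_∈ A) (+-inverseˡ-unique a b a+b≡0) a∈A)))
                                    (cong (_∸ 1) lenA))
                      j<m
          0<n∸j : 0 < n ∸ j
          0<n∸j = ℕₚ.m<n⇒0<n∸m j<n

  shiftedHP-lowCoeffs : ∀ {b} → b ∈ B → ∀ j → j < multiplicity b → coeff (shiftedHP b) j ≡ 0F
  shiftedHP-lowCoeffs {b} b∈B j j<m = trans (coeff-shiftedHP b j)
    (trans (cong (λ s → [ N C j ] *F s -F coeff 1ₚ j)
                 (sumF-cong-∈ A λ a a∈A → cong (coef A a *F_) (reduce-exponent a∈A b∈B j<m)))
           (vanish j))
    where
      vanish : ∀ j → [ N C j ] *F sumF (map (λ a → coef A a *F (a +F b) ^F (n ∸ j)) A) -F coeff 1ₚ j ≡ 0F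
      vanish zero    = trans (cong (λ s → [ N C 0 ] *F s -F 1F) (powerSum-top b))
                             (trans (cong (_-F 1F) (*-identityˡ 1F)) (-‿inverseʳ 1F))
      vanish (suc j) = trans (cong₂ (λ s t → [ N C suc j ] *F s +F t)
                                    (powerSum-low b (n ∸ suc j) (m+n∸j<n 0 1≤n (s≤s z≤n))) -0#≈0#)
                             (trans (+-identityʳ _) (zeroʳ [ N C suc j ]))

  𝕏-^multiplicity∣HPₚ : ∀ b → b ∈ B → 𝕏- b ^ multiplicity b ∣ₚ HPₚ
  𝕏-^multiplicity∣HPₚ b b∈B = drop (multiplicity b) (shiftedHP b) ∘ₚ 𝕏- b ,
    ≈-trans (≈-sym (shiftedHP∘𝕏- b))
            (∘ₚ-lowZeros (multiplicity b) (shiftedHP b) (𝕏- b) (shiftedHP-lowCoeffs b∈B))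

  rootCount-multiplicity : rootCount multiplicity B ≡ d
  rootCount-multiplicity = ℕₚ.+-cancelʳ-≡ (length (negInter A B)) (rootCount multiplicity B) d
                                          (trans (count-all B) count)
    where
      length-negInter-∷ : ∀ b B′ → length (negInter A (b ∷ B′)) ≡ eps A b + length (negInter A B′)
      length-negInter-∷ b B′ with (-F b) ∈? A
      ... | yes _ = refl
      ... | no  _ = refl
      count-all : ∀ B′ → rootCount multiplicity B′ + length (negInter A B′) ≡ length A * length B′
      count-all []       = sym (ℕₚ.*-zeroʳ (length A))
      count-all (b ∷ B′) = begin
        (multiplicity b + rootCount multiplicity B′) + length (negInter A (b ∷ B′))
          ≡⟨ cong ((multiplicity b + rootCount multiplicity B′) +_) (length-negInter-∷ b B′) ⟩
        (multiplicity b + rootCount multiplicity B′) + (eps A b + length (negInter A B′))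
          ≡⟨ ℕ-interchange (multiplicity b) _ _ _ ⟩
        (multiplicity b + eps A b) + (rootCount multiplicity B′ + length (negInter A B′))
          ≡⟨ cong₂ _+_ (ℕₚ.m∸n+n≡m (ℕₚ.≤-trans (eps≤1 b) (ℕₚ.<⇒≤ sizeA))) (count-all B′) ⟩
        length A + length A * length B′
          ≡⟨ ℕₚ.*-suc (length A) (length B′) ⟨
        length A * length (b ∷ B′)
          ∎
        where open ≡-Reasoning

  HPₚ≈•rootProduct : Σ F λ C → HPₚ ≈ C • rootProduct multiplicity B
  HPₚ≈•rootProduct =
    monic∣∧deg≤⇒≈• (rootCount multiplicity B) (rootProduct multiplicity B) HPₚ
      (Monic-rootProduct multiplicity B)
      (subst (λ k → Deg≤ k HPₚ) (sym rootCount-multiplicity) Deg≤-HPₚ)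
      (rootProduct-∣ multiplicity B HPₚ uB 𝕏-^multiplicity∣HPₚ)

module Coefficients (p : ℕ) .{{_ : NonZero p}} where
  open Fp p
  open Residue p
  open Polynomial p

  const-coeff : ∀ c → const c ≡P coeff ⟪ c ⟫
  const-coeff c zero    = refl
  const-coeff c (suc k) = refl

  X-coeff : X ≡P coeff 𝕏
  X-coeff zero          = refl
  X-coeff (suc zero)    = refl
  X-coeff (suc (suc k)) = refl

  +P-coeff : ∀ {f g} P Q → f ≡P coeff P → g ≡P coeff Q → (f +P g) ≡P coeff (P ⊕ Q)
  +P-coeff P Q f≡ g≡ k = trans (cong₂ _+F_ (f≡ k) (g≡ k)) (sym (coeff-⊕ P Q k))

  -P-coeff : ∀ {f g} P Q → f ≡P coeff P → g ≡P coeff Q → (f -P g) ≡P coeff (P ⊕ -ₚ Q)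
  -P-coeff P Q f≡ g≡ k = trans (cong₂ _-F_ (f≡ k) (g≡ k))
    (sym (trans (coeff-⊕ P (-ₚ Q) k) (cong (coeff P k +F_) (coeff--ₚ Q k))))

  *P-coeff : ∀ {f g} P Q → f ≡P coeff P → g ≡P coeff Q → (f *P g) ≡P coeff (P ⊗ Q)
  *P-coeff P Q f≡ g≡ k = trans (*P-cong f≡ g≡ k) (sym (coeff-⊗ P Q k))

  scale-coeff : ∀ {f} c P → f ≡P coeff P → scale c f ≡P coeff (c • P)
  scale-coeff c P f≡ k = trans (cong (c *F_) (f≡ k)) (sym (coeff-• c P k))

  ^P-coeff : ∀ {f} P n → f ≡P coeff P → (f ^P n) ≡P coeff (P ^ n)
  ^P-coeff P zero    f≡ = const-coeff 1F
  ^P-coeff P (suc n) f≡ = *P-coeff P (P ^ n) f≡ (^P-coeff P n f≡)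

  sumP-coeff : ∀ {I : Set} (f : I → Poly) (P : I → Pol) is → (∀ i → f i ≡P coeff (P i)) →
               sumP (map f is) ≡P coeff (sumₚ (map P is))
  sumP-coeff f P []       _ zero    = refl
  sumP-coeff f P []       _ (suc k) = refl
  sumP-coeff f P (i ∷ is) f≡ = +P-coeff (P i) (sumₚ (map P is)) (f≡ i) (sumP-coeff f P is f≡)

  X-const-coeff : ∀ b → (X -P const b) ≡P coeff (𝕏- b)
  X-const-coeff b zero          = +-identityˡ (-F b)
  X-const-coeff b (suc zero)    = trans (cong (1F +F_) -0#≈0#) (+-identityʳ 1F)
  X-const-coeff b (suc (suc k)) = trans (cong (0F +F_) -0#≈0#) (+-identityʳ 0F)

  prodP-coeff : ∀ (m : F → ℕ) B → prodP (map (λ b → (X -P const b) ^P m b) B) ≡P coeff (rootProduct m B)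
  prodP-coeff m []      = const-coeff 1F
  prodP-coeff m (b ∷ B) = *P-coeff (𝕏- b ^ m b) (rootProduct m B) (^P-coeff (𝕏- b) (m b) (X-const-coeff b)) (prodP-coeff m B)

  HP-coeff : ∀ A d → HP A d ≡P coeff (sumₚ (map (λ a → coef A a • 𝕏+ a ^ (d + length A ∸ 1)) A) ⊕ -ₚ 1ₚ)
  HP-coeff A d = -P-coeff (sumₚ (map term A)) 1ₚ
    (sumP-coeff _ term A λ a → scale-coeff (coef A a) (𝕏+ a ^ N) (^P-coeff (𝕏+ a) N (+P-coeff 𝕏 ⟪ a ⟫ X-coeff (const-coeff a))))
    (const-coeff 1F)
    where
      N = d + length A ∸ 1
      term : F → Pol
      term a = coef A a • 𝕏+ a ^ N

lemma4 : (p : ℕ) .{{_ : NonZero p}} → Prime p → (d : ℕ) → d ∣ p ∸ 1 → 1 < d → d < p ∸ 1 →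
         (A B : List (Fp.F p)) → Unique A → Unique B → Fp.Critical p d A B →
         ∃ λ (C : Fp.F p) →
           Fp._≡P_ p (Fp.HP p A d)
             (Fp.scale p C (Fp.prodP p (map (λ b → Fp._^P_ p (Fp._-P_ p (Fp.X p) (Fp.const p b)) (length A ∸ Fp.eps p A b)) B)))
lemma4 p p-prime d _ _ _ A B uA uB critical = C , λ k →
  trans (HP-coeff A d k)
        (trans (coeff≡ HP≈ k) (sym (scale-coeff C (rootProduct multiplicity B) (prodP-coeff multiplicity B) k)))
  where
    open Polynomial p using (coeff≡; rootProduct)
    open Coefficients p using (HP-coeff; scale-coeff; prodP-coeff)
    open HansonPetridis p p-prime d A B uA uB critical using (HPₚ≈•rootProduct; multiplicity)
    C = proj₁ HPₚ≈•rootProduct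
    HP≈ = proj₂ HPₚ≈•rootProduct
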